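{- Let $A\in\mathbb{F}_2[x]$ be odd and perfect. Then $$\sum_{\substack{D\mid A,\ D\neq 1,\ D\neq A\\ A/D \text{ square-free}}}\sigma(D)=0 .$$
   Context: A nonzero $A\in\mathbb{F}_2[x]$ is odd if it has no irreducible factor of degree $1$ (i.e. neither $x$ nor $x+1$ divides $A$). $\sigma(A)$ is the sum of all divisors of $A$ in $\mathbb{F}_2[x]$, and $A$ is perfect if $\sigma(A)=A$. Sums over $D\mid A$ run over all divisors of $A$ in $\mathbb{F}_2[x]$. -}

module Defs where

-- Polynomials over F₂ = Bool, as coefficient lists, lowest degree first.
-- A polynomial is *normalized* when its list is [] (the zero polynomial)
-- or its last entry is true (nonzero leading coefficient).

open import Data.Bool using (Bool; true; false; _xor_; _∧_; not; if_then_else_)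
open import Data.Bool.Properties using () renaming (_≟_ to _≟B_)
open import Data.List using (List; []; _∷_; _++_; [_]; map; concat; concatMap; upTo; length; filterᵇ; foldr; reverse)
open import Data.Bool.ListAction using (any)
open import Data.List.Properties using (≡-dec)
open import Data.Nat using (ℕ; zero; suc; _≤ᵇ_)
open import Data.Product using (_×_; _,_; proj₁; proj₂; ∃)
open import Relation.Binary.PropositionalEquality using (_≡_; _≢_)
open import Relation.Nullary.Decidable using (⌊_⌋)
open import Relation.Nullary using (¬_)

Poly : Set
Poly = List Bool

dropZeros : List Bool → List Bool
dropZeros [] = []
dropZeros (false ∷ xs) = dropZeros xs
dropZeros (true ∷ xs) = true ∷ xs

norm : Poly → Poly
norm p = reverse (dropZeros (reverse p))

data Normal : Poly → Set where
  nil  : Normal []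
  lead : ∀ xs → Normal (xs ++ [ true ])

addRaw : Poly → Poly → Poly
addRaw [] q = q
addRaw p [] = p
addRaw (a ∷ p) (b ∷ q) = (a xor b) ∷ addRaw p q

scale : Bool → Poly → Poly
scale a q = map (a ∧_) q

mulRaw : Poly → Poly → Poly
mulRaw [] q = []
mulRaw (a ∷ p) q = addRaw (scale a q) (false ∷ mulRaw p q)

infixl 6 _+P_
infixl 7 _*P_

_+P_ : Poly → Poly → Poly
p +P q = norm (addRaw p q)

_*P_ : Poly → Poly → Poly
p *P q = norm (mulRaw p q)

zeroP oneP xP x+1P : Poly
zeroP = []
oneP = true ∷ []
xP = false ∷ true ∷ []
x+1P = true ∷ true ∷ []

_∣P_ : Poly → Poly → Set
D ∣P A = ∃ λ Q → D *P Q ≡ A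

-- odd: nonzero with no irreducible factor of degree 1 (neither x nor x+1 divides)
Odd : Poly → Set
Odd A = A ≢ zeroP × ¬ (xP ∣P A) × ¬ (x+1P ∣P A)

_==_ : Poly → Poly → Bool
p == q = ⌊ ≡-dec _≟B_ p q ⌋

allBL : ℕ → List (List Bool)
allBL zero = [ [] ]
allBL (suc k) = concatMap (λ l → (false ∷ l) ∷ (true ∷ l) ∷ []) (allBL k)

-- all normalized polynomials of list-length ≤ n (i.e. degree < n), each exactly once
polysUpTo : ℕ → List Poly
polysUpTo n = [] ∷ concat (map (λ k → map (λ l → l ++ [ true ]) (allBL k)) (upTo n))

-- For normalized nonzero A every factor has degree ≤ deg A, so this is the
-- complete list of divisors D of A together with their cofactors A/D.
divPairs : Poly → List (Poly × Poly)
divPairs A = concatMap (λ D → map (λ Q → (D , Q))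
                         (filterᵇ (λ Q → (D *P Q) == A) (polysUpTo (length A))))
                       (polysUpTo (length A))

divisors : Poly → List Poly
divisors A = map proj₁ (divPairs A)

sumP : List Poly → Poly
sumP = foldr _+P_ zeroP

σ : Poly → Poly
σ A = sumP (divisors A)

Perfect : Poly → Set
Perfect A = σ A ≡ A

dividesᵇ : Poly → Poly → Bool
dividesᵇ D A = any (λ Q → (D *P Q) == A) (polysUpTo (length A))

squarefreeᵇ : Poly → Bool
squarefreeᵇ A = not (any (λ P → (2 ≤ᵇ length P) ∧ dividesᵇ (P *P P) A) (polysUpTo (length A)))

corSum : Poly → Poly
corSum A = sumP (map (λ DQ → σ (proj₁ DQ))
  (filterᵇ (λ DQ → not (proj₁ DQ == oneP) ∧ not (proj₁ DQ == A) ∧ squarefreeᵇ (proj₂ DQ))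
           (divPairs A)))

private
  open import Relation.Binary.PropositionalEquality using (refl)
  t1 : divisors (true ∷ true ∷ true ∷ []) ≡ (true ∷ []) ∷ (true ∷ true ∷ true ∷ []) ∷ []
  t1 = refl
  t2 : σ (true ∷ true ∷ true ∷ []) ≡ false ∷ true ∷ true ∷ []
  t2 = refl
  t3 : squarefreeᵇ (true ∷ false ∷ true ∷ []) ≡ false
  t3 = refl
  t4 : squarefreeᵇ (false ∷ true ∷ true ∷ []) ≡ true
  t4 = refl

module Submission where

-- Writing σ(D) = Σ_{E ∣ D} E and exchanging the order of summation,
--   Σ_{D ∣ A, A/D square-free} σ(D) = Σ_{E ∣ A} E · #{Q ∣ A/E : Q square-free}.
-- For M ≠ 1 the square-free divisors of M come in pairs Q ↔ Q P^{±1}, where P is a fixed irreducible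
-- factor of M, so over F₂ only the term E = A survives and the left-hand side equals A. The term D = A
-- contributes σ(A) = A. The term D = 1 does not occur: if A were square-free, every divisor of A
-- would be counted, so A would have an even number of divisors; as x ∤ A each divisor has constant
-- coefficient 1, so σ(A) would have constant coefficient 0, whereas A = σ(A) has constant coefficient 1.
-- Hence the sum over the remaining D is A + A = 0.

open import Defs
open import Relation.Binary.PropositionalEquality using (_≡_)

open import Algebra.Structures using (IsCommutativeSemiring)
import Algebra.Properties.CommutativeSemigroup as CommSemigroupProperties
import Algebra.Solver.Ring.AlmostCommutativeRing as ACR
import Algebra.Solver.Ring.Simple as RingSolver
open import Algebra.Bundles using (CommutativeRing)
open import Data.Bool using (Bool; true; false; T; _xor_; _∧_; not; if_then_else_)
open import Data.Bool.ListAction using (any)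
open import Data.Bool.Properties using (T?; T-∧; xor-assoc; xor-comm; xor-same; xor-identityʳ; xor-∧-commutativeRing;
  ∧-assoc; ∧-comm; ∧-zeroʳ; ∧-distribˡ-xor; ∧-distribʳ-xor) renaming (_≟_ to _≟B_)
open import Data.List using (List; []; _∷_; _++_; [_]; map; reverse; length; concatMap; upTo; filterᵇ)
open import Data.List.Properties using (≡-dec; filter-all; map-∘; concatMap-cong; map-concatMap; reverse-++;
  unfold-reverse; map-id; length-map; length-++; ++-cancelʳ)
open import Data.List.Membership.Propositional using (_∈_; lose; find)
open import Data.List.Membership.Propositional.Properties
  using (∈-concatMap⁺; ∈-concatMap⁻; ∈-filter⁺; ∈-filter⁻; ∈-map⁺; ∈-map⁻; ∈-upTo⁺; ∈-upTo⁻; ∈-∃++)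
open import Data.List.Relation.Unary.Any using (Any; here; there; any?)
open import Data.List.Relation.Unary.Any.Properties using (any⁺; any⁻)
import Data.List.Relation.Unary.All as All
open import Data.List.Relation.Unary.AllPairs using ([]; _∷_)
open import Data.List.Relation.Unary.Unique.Propositional using (Unique)
open import Data.List.Relation.Binary.BagAndSetEquality using (∼bag⇒↭)
open import Data.List.Membership.Propositional.Properties.WithK using (unique∧set⇒bag)
open import Data.List.Relation.Binary.Permutation.Propositional using (_↭_; ↭-prep; ↭-sym; ↭⇒↭ₛ; ↭⇒↭ₛ′)
open import Data.List.Relation.Binary.Permutation.Propositional.Properties using (∈-resp-↭; ↭-length; shift)
  renaming (map⁺ to ↭-map⁺)
import Data.List.Relation.Binary.Permutation.Setoid.Properties as PermutationProperties
import Data.List.Relation.Unary.Unique.Propositional.Properties as Unique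
open import Data.Nat using (ℕ; zero; suc; _+_; _∸_; _≤_; _<_; _≤ᵇ_; z≤n; s≤s)
open import Data.Nat.Properties using (≤-refl; ≤-trans; ≤-reflexive; <-irrefl; ≤-<-trans; <-≤-trans; ≤-pred;
  n≤1+n; <⇒≤; module ≤-Reasoning; ≤ᵇ⇒≤; ≤⇒≤ᵇ; suc-injective; m≤n+m; m∸n+n≡m; ≮⇒≥; _<?_; +-comm; +-mono-≤;
  +-monoʳ-≤; +-monoˡ-≤; +-cancelʳ-≤; +-cancelˡ-≤)
open import Data.Product using (_×_; _,_; proj₁; proj₂; Σ)
open import Data.Sum using (_⊎_; inj₁; inj₂)
open import Data.Empty using (⊥-elim)
open import Function using (_∘_; case_of_; Equivalence; mk⇔)
open import Relation.Nullary using (¬_; Dec; yes; no; ¬?; _×-dec_)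
open import Relation.Nullary.Decidable using (toWitness; fromWitness; toWitnessFalse; fromWitnessFalse)
open import Relation.Binary.PropositionalEquality using (_≢_; refl; sym; trans; cong; cong₂; subst; module ≡-Reasoning)
open import Relation.Binary.Structures using (IsEquivalence)
open import Relation.Binary.Bundles using (Setoid)
open import Relation.Binary.PropositionalEquality.Properties using (setoid)

open CommSemigroupProperties (CommutativeRing.+-commutativeSemigroup xor-∧-commutativeRing)
  using (x∙yz≈y∙xz; interchange)

coeff : Poly → ℕ → Bool
coeff [] _ = false
coeff (a ∷ p) zero = a
coeff (a ∷ p) (suc i) = coeff p i

infix 4 _≈_
record _≈_ (p q : Poly) : Set where
  constructor mk≈
  field at : ∀ i → coeff p i ≡ coeff q i
open _≈_

≈-refl : ∀ {p} → p ≈ p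
≈-refl = mk≈ λ i → refl

≈-sym : ∀ {p q} → p ≈ q → q ≈ p
≈-sym h = mk≈ λ i → sym (at h i)

≈-trans : ∀ {p q r} → p ≈ q → q ≈ r → p ≈ r
≈-trans h k = mk≈ λ i → trans (at h i) (at k i)

≡⇒≈ : ∀ {p q} → p ≡ q → p ≈ q
≡⇒≈ refl = ≈-refl

-- An inductive characterisation of Defs.Normal.
data NF : Poly → Set where
  nf[] : NF []
  nf∷ : ∀ a {p} → NF p → (p ≡ [] → a ≡ true) → NF (a ∷ p)

NF-tail : ∀ {a p} → NF (a ∷ p) → NF p
NF-tail (nf∷ _ h _) = h

oneP-NF : NF oneP
oneP-NF = nf∷ true nf[] (λ _ → refl)

cons : Bool → Poly → Poly
cons a (b ∷ q) = a ∷ b ∷ q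
cons false [] = []
cons true [] = true ∷ []

cons-≢[] : ∀ a q → q ≢ [] → cons a q ≡ a ∷ q
cons-≢[] a [] q≢[] = ⊥-elim (q≢[] refl)
cons-≢[] a (b ∷ q) _ = refl

coeff-cons : ∀ a q i → coeff (a ∷ q) i ≡ coeff (cons a q) i
coeff-cons a (b ∷ q) i = refl
coeff-cons false [] zero = refl
coeff-cons false [] (suc i) = refl
coeff-cons true [] i = refl

cons-NF : ∀ a {q} → NF q → NF (cons a q)
cons-NF false nf[] = nf[]
cons-NF true nf[] = oneP-NF
cons-NF a (nf∷ b h k) = nf∷ a (nf∷ b h k) (λ ())

++-[true]-≢[] : ∀ (l : Poly) → l ++ [ true ] ≢ []
++-[true]-≢[] [] ()
++-[true]-≢[] (_ ∷ _) ()

dropZeros-∷ʳ : ∀ l a → reverse (dropZeros (l ++ [ a ])) ≡ cons a (reverse (dropZeros l))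
dropZeros-∷ʳ [] false = refl
dropZeros-∷ʳ [] true = refl
dropZeros-∷ʳ (false ∷ l) a = dropZeros-∷ʳ l a
dropZeros-∷ʳ (true ∷ l) a = begin
    reverse (true ∷ l ++ [ a ])       ≡⟨ unfold-reverse true (l ++ [ a ]) ⟩
    reverse (l ++ [ a ]) ++ [ true ]  ≡⟨ cong (_++ [ true ]) (reverse-++ l [ a ]) ⟩
    a ∷ (reverse l ++ [ true ])       ≡⟨ sym (cons-≢[] a _ (++-[true]-≢[] (reverse l))) ⟩
    cons a (reverse l ++ [ true ])    ≡⟨ cong (cons a) (sym (unfold-reverse true l)) ⟩
    cons a (reverse (true ∷ l))       ∎
  where open ≡-Reasoning

norm-∷ : ∀ a p → norm (a ∷ p) ≡ cons a (norm p)
norm-∷ a p = trans (cong (λ l → reverse (dropZeros l)) (unfold-reverse a p)) (dropZeros-∷ʳ (reverse p) a)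

norm-NF : ∀ p → NF (norm p)
norm-NF [] = nf[]
norm-NF (a ∷ p) = subst NF (sym (norm-∷ a p)) (cons-NF a (norm-NF p))

norm-≈ : ∀ p → norm p ≈ p
norm-≈ p = mk≈ (go p)
  where
  go : ∀ p i → coeff (norm p) i ≡ coeff p i
  go [] i = refl
  go (a ∷ p) i = trans (cong (λ l → coeff l i) (norm-∷ a p)) (trans (sym (coeff-cons a (norm p) i)) (tail i))
    where
    tail : ∀ i → coeff (a ∷ norm p) i ≡ coeff (a ∷ p) i
    tail zero = refl
    tail (suc i) = go p i

NF-nonzero-coeff : ∀ {p} → NF p → p ≢ [] → Σ ℕ (λ i → coeff p i ≡ true)
NF-nonzero-coeff nf[] p≢[] = ⊥-elim (p≢[] refl)
NF-nonzero-coeff (nf∷ a {[]} _ k) _ = zero , k refl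
NF-nonzero-coeff (nf∷ a {_ ∷ _} np _) _ with NF-nonzero-coeff np (λ ())
... | i , e = suc i , e

NF-unique : ∀ {p q} → NF p → NF q → p ≈ q → p ≡ q
NF-unique nf[] nf[] h = refl
NF-unique nf[] (nf∷ b nq k) h with NF-nonzero-coeff (nf∷ b nq k) (λ ())
... | i , e with () ← trans (at h i) e
NF-unique (nf∷ a np k) nf[] h with NF-nonzero-coeff (nf∷ a np k) (λ ())
... | i , e with () ← trans (sym (at h i)) e
NF-unique (nf∷ a np _) (nf∷ b nq _) h = cong₂ _∷_ (at h zero) (NF-unique np nq (mk≈ λ i → at h (suc i)))

norm-cong : ∀ {p q} → p ≈ q → norm p ≡ norm q
norm-cong {p} {q} h = NF-unique (norm-NF p) (norm-NF q) (≈-trans (norm-≈ p) (≈-trans h (≈-sym (norm-≈ q))))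

norm-idem : ∀ {p} → NF p → norm p ≡ p
norm-idem {p} np = NF-unique (norm-NF p) np (norm-≈ p)

norm-≡⇒≈ : ∀ {p q} → norm p ≡ norm q → p ≈ q
norm-≡⇒≈ {p} {q} e = ≈-trans (≈-sym (norm-≈ p)) (≈-trans (≡⇒≈ e) (norm-≈ q))

coeff-addRaw : ∀ p q i → coeff (addRaw p q) i ≡ coeff p i xor coeff q i
coeff-addRaw [] q i = refl
coeff-addRaw (a ∷ p) [] zero = sym (xor-identityʳ a)
coeff-addRaw (a ∷ p) [] (suc i) = sym (xor-identityʳ _)
coeff-addRaw (a ∷ p) (b ∷ q) zero = refl
coeff-addRaw (a ∷ p) (b ∷ q) (suc i) = coeff-addRaw p q i

coeff-scale : ∀ a q i → coeff (scale a q) i ≡ a ∧ coeff q i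
coeff-scale a [] i = sym (∧-zeroʳ a)
coeff-scale a (b ∷ q) zero = refl
coeff-scale a (b ∷ q) (suc i) = coeff-scale a q i

coeff-[false] : ∀ i → coeff (false ∷ []) i ≡ false
coeff-[false] zero = refl
coeff-[false] (suc i) = refl

coeff-mulRaw-∷ : ∀ a p q i → coeff (mulRaw (a ∷ p) q) i ≡ (a ∧ coeff q i) xor coeff (false ∷ mulRaw p q) i
coeff-mulRaw-∷ a p q i =
  trans (coeff-addRaw (scale a q) (false ∷ mulRaw p q) i) (cong (_xor coeff (false ∷ mulRaw p q) i) (coeff-scale a q i))

addRaw-cong : ∀ {p p' q q'} → p ≈ p' → q ≈ q' → addRaw p q ≈ addRaw p' q'
addRaw-cong {p} {p'} {q} {q'} h k = mk≈ λ i →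
  trans (coeff-addRaw p q i) (trans (cong₂ _xor_ (at h i) (at k i)) (sym (coeff-addRaw p' q' i)))

false∷-cong : ∀ {p q} → p ≈ q → false ∷ p ≈ false ∷ q
false∷-cong h = mk≈ λ { zero → refl ; (suc i) → at h i }

scale-cong : ∀ a {p q} → p ≈ q → scale a p ≈ scale a q
scale-cong a {p} {q} h = mk≈ λ i →
  trans (coeff-scale a p i) (trans (cong (a ∧_) (at h i)) (sym (coeff-scale a q i)))

mulRaw-congʳ : ∀ p {q q'} → q ≈ q' → mulRaw p q ≈ mulRaw p q'
mulRaw-congʳ [] h = ≈-refl
mulRaw-congʳ (a ∷ p) h = addRaw-cong (scale-cong a h) (false∷-cong (mulRaw-congʳ p h))

mulRaw-cons : ∀ a r q → mulRaw (cons a r) q ≈ mulRaw (a ∷ r) q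
mulRaw-cons a (b ∷ r) q = ≈-refl
mulRaw-cons true [] q = ≈-refl
mulRaw-cons false [] q = mk≈ λ i → sym (trans (coeff-mulRaw-∷ false [] q i) (coeff-[false] i))

mulRaw-norm : ∀ p q → mulRaw p q ≈ mulRaw (norm p) q
mulRaw-norm [] q = ≈-refl
mulRaw-norm (a ∷ p) q =
  ≈-trans (addRaw-cong (≈-refl {scale a q}) (false∷-cong (mulRaw-norm p q)))
  (≈-trans (≈-sym (mulRaw-cons a (norm p) q)) (≡⇒≈ (cong (λ l → mulRaw l q) (sym (norm-∷ a p)))))

mulRaw-congˡ : ∀ {p p'} q → p ≈ p' → mulRaw p q ≈ mulRaw p' q
mulRaw-congˡ {p} {p'} q h =
  ≈-trans (mulRaw-norm p q) (≈-trans (≡⇒≈ (cong (λ l → mulRaw l q) (norm-cong h))) (≈-sym (mulRaw-norm p' q)))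

addRaw-comm : ∀ p q → addRaw p q ≈ addRaw q p
addRaw-comm p q = mk≈ λ i →
  trans (coeff-addRaw p q i) (trans (xor-comm (coeff p i) (coeff q i)) (sym (coeff-addRaw q p i)))

addRaw-assoc : ∀ p q r → addRaw (addRaw p q) r ≈ addRaw p (addRaw q r)
addRaw-assoc p q r = mk≈ λ i → begin
  coeff (addRaw (addRaw p q) r) i           ≡⟨ coeff-addRaw (addRaw p q) r i ⟩
  coeff (addRaw p q) i xor coeff r i        ≡⟨ cong (_xor coeff r i) (coeff-addRaw p q i) ⟩
  (coeff p i xor coeff q i) xor coeff r i   ≡⟨ xor-assoc (coeff p i) (coeff q i) (coeff r i) ⟩
  coeff p i xor (coeff q i xor coeff r i)   ≡⟨ cong (coeff p i xor_) (sym (coeff-addRaw q r i)) ⟩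
  coeff p i xor coeff (addRaw q r) i        ≡⟨ sym (coeff-addRaw p (addRaw q r) i) ⟩
  coeff (addRaw p (addRaw q r)) i           ∎
  where open ≡-Reasoning

addRaw-self : ∀ p → addRaw p p ≈ []
addRaw-self p = mk≈ λ i → trans (coeff-addRaw p p i) (xor-same (coeff p i))

addRaw-identityʳ : ∀ p → addRaw p [] ≈ p
addRaw-identityʳ p = mk≈ λ i → trans (coeff-addRaw p [] i) (xor-identityʳ (coeff p i))

mulRaw-zeroʳ : ∀ p → mulRaw p [] ≈ []
mulRaw-zeroʳ [] = ≈-refl
mulRaw-zeroʳ (a ∷ p) = mk≈ λ i → trans (coeff-mulRaw-∷ a p [] i)
  (trans (cong₂ _xor_ (∧-zeroʳ a) (trans (at (false∷-cong (mulRaw-zeroʳ p)) i) (coeff-[false] i))) refl)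

mulRaw-identityˡ : ∀ q → mulRaw oneP q ≈ q
mulRaw-identityˡ q = mk≈ λ i →
  trans (coeff-mulRaw-∷ true [] q i) (trans (cong (coeff q i xor_) (coeff-[false] i)) (xor-identityʳ (coeff q i)))

mulRaw-∷ʳ : ∀ p b q → mulRaw p (b ∷ q) ≈ addRaw (scale b p) (false ∷ mulRaw p q)
mulRaw-∷ʳ [] b q = mk≈ λ { zero → refl ; (suc i) → refl }
mulRaw-∷ʳ (a ∷ p) b q = mk≈ go
  where
  go : ∀ i → coeff (mulRaw (a ∷ p) (b ∷ q)) i ≡ coeff (addRaw (scale b (a ∷ p)) (false ∷ mulRaw (a ∷ p) q)) i
  go zero = cong (_xor false) (∧-comm a b)
  go (suc i) = begin
    coeff (mulRaw (a ∷ p) (b ∷ q)) (suc i)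
      ≡⟨ coeff-mulRaw-∷ a p (b ∷ q) (suc i) ⟩
    (a ∧ coeff q i) xor coeff (mulRaw p (b ∷ q)) i
      ≡⟨ cong ((a ∧ coeff q i) xor_) (at (mulRaw-∷ʳ p b q) i) ⟩
    (a ∧ coeff q i) xor coeff (addRaw (scale b p) (false ∷ mulRaw p q)) i
      ≡⟨ cong ((a ∧ coeff q i) xor_) (coeff-addRaw (scale b p) (false ∷ mulRaw p q) i) ⟩
    (a ∧ coeff q i) xor (coeff (scale b p) i xor coeff (false ∷ mulRaw p q) i)
      ≡⟨ x∙yz≈y∙xz (a ∧ coeff q i) (coeff (scale b p) i) (coeff (false ∷ mulRaw p q) i) ⟩
    coeff (scale b p) i xor ((a ∧ coeff q i) xor coeff (false ∷ mulRaw p q) i)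
      ≡⟨ cong (coeff (scale b p) i xor_) (sym (coeff-mulRaw-∷ a p q i)) ⟩
    coeff (scale b p) i xor coeff (mulRaw (a ∷ p) q) i
      ≡⟨ sym (coeff-addRaw (scale b (a ∷ p)) (false ∷ mulRaw (a ∷ p) q) (suc i)) ⟩
    coeff (addRaw (scale b (a ∷ p)) (false ∷ mulRaw (a ∷ p) q)) (suc i) ∎
    where open ≡-Reasoning

mulRaw-comm : ∀ p q → mulRaw p q ≈ mulRaw q p
mulRaw-comm [] q = ≈-sym (mulRaw-zeroʳ q)
mulRaw-comm (a ∷ p) q =
  ≈-trans (addRaw-cong (≈-refl {scale a q}) (false∷-cong (mulRaw-comm p q))) (≈-sym (mulRaw-∷ʳ q a p))

mulRaw-distribʳ : ∀ p q r → mulRaw (addRaw p q) r ≈ addRaw (mulRaw p r) (mulRaw q r)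
mulRaw-distribʳ [] q r = ≈-refl
mulRaw-distribʳ (a ∷ p) [] r = ≈-sym (addRaw-identityʳ _)
mulRaw-distribʳ (a ∷ p) (b ∷ q) r = mk≈ λ i → begin
  coeff (mulRaw ((a xor b) ∷ addRaw p q) r) i
    ≡⟨ coeff-mulRaw-∷ (a xor b) (addRaw p q) r i ⟩
  ((a xor b) ∧ coeff r i) xor coeff (false ∷ mulRaw (addRaw p q) r) i
    ≡⟨ cong₂ _xor_ (∧-distribʳ-xor (coeff r i) a b) (at (false∷-cong (mulRaw-distribʳ p q r)) i) ⟩
  ((a ∧ coeff r i) xor (b ∧ coeff r i)) xor coeff (false ∷ addRaw (mulRaw p r) (mulRaw q r)) i
    ≡⟨ cong (((a ∧ coeff r i) xor (b ∧ coeff r i)) xor_)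
         (coeff-addRaw (false ∷ mulRaw p r) (false ∷ mulRaw q r) i) ⟩
  ((a ∧ coeff r i) xor (b ∧ coeff r i)) xor (coeff (false ∷ mulRaw p r) i xor coeff (false ∷ mulRaw q r) i)
    ≡⟨ interchange (a ∧ coeff r i) (b ∧ coeff r i) (coeff (false ∷ mulRaw p r) i) (coeff (false ∷ mulRaw q r) i) ⟩
  ((a ∧ coeff r i) xor coeff (false ∷ mulRaw p r) i) xor ((b ∧ coeff r i) xor coeff (false ∷ mulRaw q r) i)
    ≡⟨ sym (cong₂ _xor_ (coeff-mulRaw-∷ a p r i) (coeff-mulRaw-∷ b q r i)) ⟩
  coeff (mulRaw (a ∷ p) r) i xor coeff (mulRaw (b ∷ q) r) i
    ≡⟨ sym (coeff-addRaw (mulRaw (a ∷ p) r) (mulRaw (b ∷ q) r) i) ⟩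
  coeff (addRaw (mulRaw (a ∷ p) r) (mulRaw (b ∷ q) r)) i ∎
  where open ≡-Reasoning

mulRaw-scale : ∀ a q r → mulRaw (scale a q) r ≈ scale a (mulRaw q r)
mulRaw-scale a [] r = mk≈ λ i → sym (trans (coeff-scale a [] i) (∧-zeroʳ a))
mulRaw-scale a (b ∷ q) r = mk≈ λ i → begin
  coeff (mulRaw ((a ∧ b) ∷ scale a q) r) i
    ≡⟨ coeff-mulRaw-∷ (a ∧ b) (scale a q) r i ⟩
  ((a ∧ b) ∧ coeff r i) xor coeff (false ∷ mulRaw (scale a q) r) i
    ≡⟨ cong₂ _xor_ (∧-assoc a b (coeff r i))
                   (trans (at (false∷-cong (mulRaw-scale a q r)) i) (coeff-false∷-scale i)) ⟩
  (a ∧ (b ∧ coeff r i)) xor (a ∧ coeff (false ∷ mulRaw q r) i)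
    ≡⟨ sym (∧-distribˡ-xor a (b ∧ coeff r i) (coeff (false ∷ mulRaw q r) i)) ⟩
  a ∧ ((b ∧ coeff r i) xor coeff (false ∷ mulRaw q r) i)
    ≡⟨ cong (a ∧_) (sym (coeff-mulRaw-∷ b q r i)) ⟩
  a ∧ coeff (mulRaw (b ∷ q) r) i
    ≡⟨ sym (coeff-scale a (mulRaw (b ∷ q) r) i) ⟩
  coeff (scale a (mulRaw (b ∷ q) r)) i ∎
  where
  open ≡-Reasoning
  coeff-false∷-scale : ∀ i → coeff (false ∷ scale a (mulRaw q r)) i ≡ a ∧ coeff (false ∷ mulRaw q r) i
  coeff-false∷-scale zero = sym (∧-zeroʳ a)
  coeff-false∷-scale (suc i) = coeff-scale a (mulRaw q r) i

mulRaw-false∷ : ∀ s r → mulRaw (false ∷ s) r ≈ false ∷ mulRaw s r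
mulRaw-false∷ s r = mk≈ (coeff-mulRaw-∷ false s r)

mulRaw-assoc : ∀ p q r → mulRaw (mulRaw p q) r ≈ mulRaw p (mulRaw q r)
mulRaw-assoc [] q r = ≈-refl
mulRaw-assoc (a ∷ p) q r =
  ≈-trans (mulRaw-distribʳ (scale a q) (false ∷ mulRaw p q) r)
    (addRaw-cong (mulRaw-scale a q r) (≈-trans (mulRaw-false∷ (mulRaw p q) r) (false∷-cong (mulRaw-assoc p q r))))

+P-NF : ∀ p q → NF (p +P q)
+P-NF p q = norm-NF (addRaw p q)

*P-NF : ∀ p q → NF (p *P q)
*P-NF p q = norm-NF (mulRaw p q)

+P-comm : ∀ p q → p +P q ≡ q +P p
+P-comm p q = norm-cong (addRaw-comm p q)

+P-assoc : ∀ p q r → (p +P q) +P r ≡ p +P (q +P r)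
+P-assoc p q r = norm-cong (≈-trans (addRaw-cong (norm-≈ (addRaw p q)) (≈-refl {r}))
  (≈-trans (addRaw-assoc p q r) (addRaw-cong (≈-refl {p}) (≈-sym (norm-≈ (addRaw q r))))))

+P-identityʳ : ∀ p → p +P [] ≡ norm p
+P-identityʳ p = norm-cong (addRaw-identityʳ p)

+P-self : ∀ p → p +P p ≡ []
+P-self p = norm-cong (addRaw-self p)

*P-comm : ∀ p q → p *P q ≡ q *P p
*P-comm p q = norm-cong (mulRaw-comm p q)

*P-assoc : ∀ p q r → (p *P q) *P r ≡ p *P (q *P r)
*P-assoc p q r = norm-cong (≈-trans (mulRaw-congˡ r (norm-≈ (mulRaw p q)))
  (≈-trans (mulRaw-assoc p q r) (mulRaw-congʳ p (≈-sym (norm-≈ (mulRaw q r))))))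

*P-identityˡ : ∀ p → oneP *P p ≡ norm p
*P-identityˡ p = norm-cong (mulRaw-identityˡ p)

*P-identityʳ : ∀ {p} → NF p → p *P oneP ≡ p
*P-identityʳ {p} np = trans (*P-comm p oneP) (trans (*P-identityˡ p) (norm-idem np))

*P-zeroʳ : ∀ p → p *P [] ≡ []
*P-zeroʳ p = norm-cong (mulRaw-zeroʳ p)

*P-distribʳ : ∀ p q r → (p +P q) *P r ≡ (p *P r) +P (q *P r)
*P-distribʳ p q r = norm-cong (≈-trans (mulRaw-congˡ r (norm-≈ (addRaw p q)))
  (≈-trans (mulRaw-distribʳ p q r) (addRaw-cong (≈-sym (norm-≈ (mulRaw p r))) (≈-sym (norm-≈ (mulRaw q r))))))

*P-distribˡ : ∀ p q r → p *P (q +P r) ≡ (p *P q) +P (p *P r)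
*P-distribˡ p q r = trans (*P-comm p _) (trans (*P-distribʳ q r p) (cong₂ _+P_ (*P-comm q p) (*P-comm r p)))

-- [] is an identity for _+P_ only up to normalisation, hence the semiring laws hold for this equality.
infix 4 _≈N_
record _≈N_ (p q : Poly) : Set where
  constructor mk≈N
  field norm-≡ : norm p ≡ norm q

≡⇒≈N : ∀ {p q} → p ≡ q → p ≈N q
≡⇒≈N refl = mk≈N refl

≈N⇒≡ : ∀ {p q} → NF p → NF q → p ≈N q → p ≡ q
≈N⇒≡ np nq (mk≈N e) = trans (sym (norm-idem np)) (trans e (norm-idem nq))

≈N-isEquivalence : IsEquivalence _≈N_
≈N-isEquivalence = record
  { refl = mk≈N refl
  ; sym = λ (mk≈N e) → mk≈N (sym e)
  ; trans = λ (mk≈N e) (mk≈N f) → mk≈N (trans e f) }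

norm-norm : ∀ p → norm (norm p) ≡ norm p
norm-norm p = norm-idem (norm-NF p)

+P-cong : ∀ {p p' q q'} → p ≈N p' → q ≈N q' → p +P q ≈N p' +P q'
+P-cong {p} {p'} {q} {q'} (mk≈N e) (mk≈N f) = mk≈N (trans (norm-norm (addRaw p q))
  (trans (norm-cong (addRaw-cong (norm-≡⇒≈ {p} {p'} e) (norm-≡⇒≈ {q} {q'} f))) (sym (norm-norm (addRaw p' q')))))

*P-cong : ∀ {p p' q q'} → p ≈N p' → q ≈N q' → p *P q ≈N p' *P q'
*P-cong {p} {p'} {q} {q'} (mk≈N e) (mk≈N f) = mk≈N (trans (norm-norm (mulRaw p q))
  (trans (norm-cong (≈-trans (mulRaw-congˡ q (norm-≡⇒≈ {p} {p'} e)) (mulRaw-congʳ p' (norm-≡⇒≈ {q} {q'} f))))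
    (sym (norm-norm (mulRaw p' q')))))

+P-*P-isCommutativeSemiring : IsCommutativeSemiring _≈N_ _+P_ _*P_ [] oneP
+P-*P-isCommutativeSemiring = record
  { isSemiring = record
    { isSemiringWithoutAnnihilatingZero = record
      { +-isCommutativeMonoid = record
        { isMonoid = record
          { isSemigroup = record
            { isMagma = record { isEquivalence = ≈N-isEquivalence ; ∙-cong = +P-cong }
            ; assoc = λ p q r → ≡⇒≈N {(p +P q) +P r} {p +P (q +P r)} (+P-assoc p q r) }
          ; identity = (λ p → mk≈N (norm-norm p))
                     , (λ p → mk≈N (trans (norm-norm (addRaw p [])) (+P-identityʳ p))) }
        ; comm = λ p q → ≡⇒≈N {p +P q} {q +P p} (+P-comm p q) }
      ; *-cong = *P-cong
      ; *-assoc = λ p q r → ≡⇒≈N {(p *P q) *P r} {p *P (q *P r)} (*P-assoc p q r)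
      ; *-identity = (λ p → mk≈N (trans (cong norm (*P-identityˡ p)) (norm-norm p)))
                   , (λ p → mk≈N (trans (cong norm (trans (*P-comm p oneP) (*P-identityˡ p))) (norm-norm p)))
      ; distrib = (λ p q r → ≡⇒≈N {p *P (q +P r)} {(p *P q) +P (p *P r)} (*P-distribˡ p q r))
                , (λ p q r → ≡⇒≈N {(q +P r) *P p} {(q *P p) +P (r *P p)} (*P-distribʳ q r p)) }
    ; zero = (λ p → mk≈N refl) , (λ p → ≡⇒≈N {p *P []} {[]} (*P-zeroʳ p)) }
  ; *-comm = λ p q → ≡⇒≈N {p *P q} {q *P p} (*P-comm p q) }

-- Characteristic 2: negation is the identity.
F₂[x] : ACR.AlmostCommutativeRing _ _
F₂[x] = record
  { Carrier = Poly ; _≈_ = _≈N_ ; _+_ = _+P_ ; _*_ = _*P_ ; -_ = λ p → p ; 0# = [] ; 1# = oneP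
  ; isAlmostCommutativeRing = record
    { isCommutativeSemiring = +P-*P-isCommutativeSemiring
    ; -‿cong = λ e → e
    ; -‿*-distribˡ = λ _ _ → mk≈N refl
    ; -‿+-comm = λ _ _ → mk≈N refl } }

_≈N?_ : ∀ p q → Dec (p ≈N q)
p ≈N? q with ≡-dec _≟B_ (norm p) (norm q)
... | yes e = yes (mk≈N e)
... | no ne = no λ (mk≈N e) → ne e

open RingSolver F₂[x] _≈N?_ using (solve; _:=_; _:+_; _:*_)

-- Degrees and the absence of zero divisors

addRaw-shorter : ∀ s t → length s < length t → NF t → NF (addRaw s t) × length (addRaw s t) ≡ length t
addRaw-shorter [] t _ nt = nt , refl
addRaw-shorter (x ∷ s) (y ∷ []) (s≤s ()) _
addRaw-shorter (x ∷ s) (y ∷ t@(_ ∷ _)) (s≤s s<t) nt with addRaw-shorter s t s<t (NF-tail nt)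
... | ns+t , len = nf∷ (x xor y) ns+t (λ e → ⊥-elim (≢[]-length len e)) , cong suc len
  where
  ≢[]-length : length (addRaw s t) ≡ length t → addRaw s t ≢ []
  ≢[]-length len e with () ← trans (sym len) (cong length e)

mulRaw-oneˡ : ∀ q → q ≢ [] → mulRaw oneP q ≡ q
mulRaw-oneˡ [] q≢[] = ⊥-elim (q≢[] refl)
mulRaw-oneˡ (b ∷ q) _ = cong₂ _∷_ (xor-identityʳ b) (trans (addRaw-[]ʳ (map (true ∧_) q)) (map-id q))
  where
  addRaw-[]ʳ : ∀ l → addRaw l [] ≡ l
  addRaw-[]ʳ [] = refl
  addRaw-[]ʳ (_ ∷ _) = refl

length-≢[] : ∀ {q : Poly} → q ≢ [] → 1 ≤ length q
length-≢[] {[]} q≢[] = ⊥-elim (q≢[] refl)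
length-≢[] {_ ∷ _} _ = s≤s z≤n

mulRaw-NF : ∀ a p q → NF (a ∷ p) → NF q → q ≢ [] →
            NF (mulRaw (a ∷ p) q) × length (mulRaw (a ∷ p) q) ≡ length p + length q
mulRaw-NF a [] q (nf∷ .a _ a≡true) nq q≢[] rewrite a≡true refl | mulRaw-oneˡ q q≢[] = nq , refl
mulRaw-NF a (a' ∷ p) q np nq q≢[] with mulRaw-NF a' p q (NF-tail np) nq q≢[]
... | nm , lm = proj₁ sum , trans (proj₂ sum) (cong suc lm)
  where
  m = mulRaw (a' ∷ p) q
  m≢[] : m ≢ []
  m≢[] e = <-irrefl refl (≤-trans (≤-trans (length-≢[] q≢[]) (m≤n+m (length q) (length p)))
                                  (≤-reflexive (trans (sym lm) (cong length e))))
  scale<x·m : length (scale a q) < suc (length m)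
  scale<x·m rewrite length-map (a ∧_) q | lm = s≤s (m≤n+m (length q) (length p))
  sum = addRaw-shorter (scale a q) (false ∷ m) scale<x·m (nf∷ false nm (⊥-elim ∘ m≢[]))

mulRaw-NF-length : ∀ {p q} → NF p → NF q → p ≢ [] → q ≢ [] →
                   NF (mulRaw p q) × suc (length (mulRaw p q)) ≡ length p + length q
mulRaw-NF-length {[]} _ _ p≢[] _ = ⊥-elim (p≢[] refl)
mulRaw-NF-length {a ∷ p} {q} np nq _ q≢[] = proj₁ r , cong suc (proj₂ r)
  where r = mulRaw-NF a p q np nq q≢[]

module _ {p q} (np : NF p) (nq : NF q) (p≢[] : p ≢ []) (q≢[] : q ≢ []) where

  private
    raw = mulRaw-NF-length np nq p≢[] q≢[]

  *P≡mulRaw : p *P q ≡ mulRaw p q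
  *P≡mulRaw = norm-idem (proj₁ raw)

  *P-length : suc (length (p *P q)) ≡ length p + length q
  *P-length = trans (cong (λ l → suc (length l)) *P≡mulRaw) (proj₂ raw)

  *P-≢[] : p *P q ≢ []
  *P-≢[] e = <-irrefl refl (≤-trans (+-mono-≤ (length-≢[] p≢[]) (length-≢[] q≢[]))
    (≤-reflexive (trans (sym *P-length) (cong (suc ∘ length) e))))

*P-≡[] : ∀ {p q} → NF p → NF q → p *P q ≡ [] → p ≡ [] ⊎ q ≡ []
*P-≡[] {[]} _ _ _ = inj₁ refl
*P-≡[] {_ ∷ _} {[]} _ _ _ = inj₂ refl
*P-≡[] {_ ∷ _} {_ ∷ _} np nq e = ⊥-elim (*P-≢[] np nq (λ ()) (λ ()) e)

+P-≡[] : ∀ {p q} → NF p → NF q → p +P q ≡ [] → p ≡ q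
+P-≡[] {p} {q} np nq e = NF-unique np nq (mk≈ λ i → xor≡false (coeff p i) (coeff q i)
  (trans (sym (coeff-addRaw p q i)) (at (norm-≡⇒≈ {addRaw p q} {[]} e) i)))
  where
  xor≡false : ∀ x y → x xor y ≡ false → x ≡ y
  xor≡false false false _ = refl
  xor≡false true true _ = refl

*P-cancelˡ : ∀ {D Q Q'} → NF D → D ≢ [] → NF Q → NF Q' → D *P Q ≡ D *P Q' → Q ≡ Q'
*P-cancelˡ {D} {Q} {Q'} nD D≢[] nQ nQ' e with *P-≡[] nD (+P-NF Q Q') D·[Q+Q']≡[]
  where
  D·[Q+Q']≡[] : D *P (Q +P Q') ≡ []
  D·[Q+Q']≡[] = trans (*P-distribˡ D Q Q') (trans (cong (_+P (D *P Q')) e) (+P-self (D *P Q')))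
... | inj₁ D≡[] = ⊥-elim (D≢[] D≡[])
... | inj₂ Q+Q'≡[] = +P-≡[] nQ nQ' Q+Q'≡[]

factor-length : ∀ {D Q} → NF D → NF Q → D *P Q ≢ [] → length D ≤ length (D *P Q) × length Q ≤ length (D *P Q)
factor-length {D} {Q} nD nQ DQ≢[] = +-cancelʳ-≤ 1 _ _ lD , +-cancelˡ-≤ 1 _ _ lQ
  where
  D≢[] : D ≢ []
  D≢[] refl = DQ≢[] refl
  Q≢[] : Q ≢ []
  Q≢[] refl = DQ≢[] (*P-zeroʳ D)
  len = *P-length nD nQ D≢[] Q≢[]
  lD : length D + 1 ≤ length (D *P Q) + 1
  lD = subst (length D + 1 ≤_) (trans (sym len) (+-comm 1 _)) (+-monoʳ-≤ (length D) (length-≢[] Q≢[]))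
  lQ : 1 + length Q ≤ 1 + length (D *P Q)
  lQ = subst (1 + length Q ≤_) (sym len) (+-monoˡ-≤ (length Q) (length-≢[] D≢[]))

-- Division with remainder, Bézout and Euclid's lemma

infix 4 _∣_
record _∣_ (D A : Poly) : Set where
  constructor divides
  field
    cofactor : Poly
    cofactor-NF : NF cofactor
    equation : D *P cofactor ≡ A
open _∣_

length-cons : ∀ a q → length (cons a q) ≤ suc (length q)
length-cons a (b ∷ q) = ≤-refl
length-cons false [] = z≤n
length-cons true [] = ≤-refl

-- Two normal forms of the same degree have equal leading coefficients, which cancel.
+P-length-< : ∀ {s t} → NF s → NF t → length s ≡ length t → s ≢ [] → length (s +P t) < length s
+P-length-< {[]} _ _ _ s≢[] = ⊥-elim (s≢[] refl)
+P-length-< {a ∷ []} {b ∷ []} (nf∷ _ _ a≡true) (nf∷ _ _ b≡true) _ _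
  rewrite a≡true refl | b≡true refl = s≤s z≤n
+P-length-< {_ ∷ []} {_ ∷ _ ∷ _} _ _ () _
+P-length-< {_ ∷ _ ∷ _} {_ ∷ []} _ _ () _
+P-length-< {a ∷ s@(_ ∷ _)} {b ∷ t@(_ ∷ _)} ns nt e _ =
  subst (λ l → length l < suc (length s)) (sym (norm-∷ (a xor b) (addRaw s t)))
    (≤-<-trans (length-cons (a xor b) (norm (addRaw s t)))
      (s≤s (+P-length-< {s} {t} (NF-tail ns) (NF-tail nt) (suc-injective e) (λ ()))))

xPow : ℕ → Poly
xPow zero = oneP
xPow (suc k) = false ∷ xPow k

xPow-≢[] : ∀ k → xPow k ≢ []
xPow-≢[] zero ()
xPow-≢[] (suc k) ()

xPow-NF : ∀ k → NF (xPow k)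
xPow-NF zero = oneP-NF
xPow-NF (suc k) = nf∷ false (xPow-NF k) (λ e → ⊥-elim (xPow-≢[] k e))

length-xPow : ∀ k → length (xPow k) ≡ suc k
length-xPow zero = refl
length-xPow (suc k) = cong suc (length-xPow k)

record DivMod (A B : Poly) : Set where
  constructor divMod
  field
    quotient remainder : Poly
    quotient-NF : NF quotient
    remainder-NF : NF remainder
    division : A ≡ (B *P quotient) +P remainder
    remainder-< : length remainder < length B

-- Long division; the fuel n bounds the length of the dividend.
divMod-fuel : ∀ n {A B} → NF A → NF B → B ≢ [] → length A ≤ n → DivMod A B
divMod-fuel n {A} {B} nA nB B≢[] A≤n with length A <? length B
... | yes A<B = divMod [] A nf[] nA (sym (trans (cong (_+P A) (*P-zeroʳ B)) (norm-idem nA))) A<B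
divMod-fuel zero nA nB B≢[] A≤n | no A≮B = ⊥-elim (A≮B (≤-trans (s≤s A≤n) (length-≢[] B≢[])))
divMod-fuel (suc n) {A} {B} nA nB B≢[] A≤n | no A≮B = divMod (q +P X) r (+P-NF q X) nr division′ r<B
  where
  k = length A ∸ length B
  X = xPow k
  A≢[] : A ≢ []
  A≢[] refl = A≮B (length-≢[] B≢[])
  length-XB : length (X *P B) ≡ length A
  length-XB = suc-injective (trans (*P-length (xPow-NF k) nB (xPow-≢[] k) B≢[])
    (trans (cong (_+ length B) (length-xPow k)) (cong suc (m∸n+n≡m (≮⇒≥ A≮B)))))
  A+XB<A : length (A +P X *P B) < length A
  A+XB<A = +P-length-< nA (*P-NF X B) (sym length-XB) A≢[]
  open DivMod (divMod-fuel n (+P-NF A (X *P B)) nB B≢[] (≤-pred (≤-trans A+XB<A A≤n)))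
    renaming (quotient to q; remainder to r; remainder-NF to nr; division to A+XB≡Bq+r; remainder-< to r<B)
  division′ : A ≡ (B *P (q +P X)) +P r
  division′ = begin
    A                             ≡⟨ ≈N⇒≡ nA (+P-NF (A +P X *P B) (X *P B))
                                       (solve 3 (λ a x b → a := (a :+ x :* b) :+ x :* b) (mk≈N refl) A X B) ⟩
    (A +P X *P B) +P X *P B       ≡⟨ cong (_+P X *P B) A+XB≡Bq+r ⟩
    ((B *P q) +P r) +P X *P B     ≡⟨ ≈N⇒≡ (+P-NF ((B *P q) +P r) (X *P B)) (+P-NF (B *P (q +P X)) r)
                                       (solve 4 (λ b q r x → ((b :* q) :+ r) :+ x :* b := (b :* (q :+ x)) :+ r)
                                         (mk≈N refl) B q r X) ⟩
    (B *P (q +P X)) +P r          ∎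
    where open ≡-Reasoning

divMod′ : ∀ {A B} → NF A → NF B → B ≢ [] → DivMod A B
divMod′ {A} nA nB B≢[] = divMod-fuel (length A) nA nB B≢[] ≤-refl

-- B divides r and is longer than r.
∣⇒remainder≡[] : ∀ {A B q r} → NF B → NF r → B ∣ A → A ≡ (B *P q) +P r → length r < length B → r ≡ []
∣⇒remainder≡[] {r = []} _ _ _ _ _ = refl
∣⇒remainder≡[] {A} {B} {q} {r@(_ ∷ _)} nB nr (divides c nc Bc≡A) division r<B =
  ⊥-elim (<-irrefl refl (<-≤-trans r<B (subst (λ z → length B ≤ length z) B[q+c]≡r
    (proj₁ (factor-length nB (+P-NF q c) (λ e → case trans (sym B[q+c]≡r) e of λ ()))))))
  where
  B[q+c]≡r : B *P (q +P c) ≡ r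
  B[q+c]≡r = begin
    B *P (q +P c)                    ≡⟨ *P-distribˡ B q c ⟩
    (B *P q) +P (B *P c)             ≡⟨ cong ((B *P q) +P_) (trans Bc≡A division) ⟩
    (B *P q) +P ((B *P q) +P r)      ≡⟨ ≈N⇒≡ (+P-NF (B *P q) ((B *P q) +P r)) nr
                                          (solve 2 (λ a b → a :+ (a :+ b) := b) (mk≈N refl) (B *P q) r) ⟩
    r                                ∎
    where open ≡-Reasoning

module ExactDivision {B : Poly} (nB : NF B) (B≢[] : B ≢ []) where

  private
    divMod-B : ∀ X → DivMod (norm X) B
    divMod-B X = divMod′ (norm-NF X) nB B≢[]

  -- junk when B does not divide X
  quot : Poly → Poly
  quot X = DivMod.quotient (divMod-B X)

  quot-NF : ∀ X → NF (quot X)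
  quot-NF X = DivMod.quotient-NF (divMod-B X)

  quot-exact : ∀ {X} → NF X → B ∣ X → B *P quot X ≡ X
  quot-exact {X} nX B∣X = begin
    B *P q               ≡⟨ sym (norm-idem (*P-NF B q)) ⟩
    norm (B *P q)        ≡⟨ sym (+P-identityʳ (B *P q)) ⟩
    (B *P q) +P []       ≡⟨ cong ((B *P q) +P_) (sym r≡[]) ⟩
    (B *P q) +P r        ≡⟨ sym division ⟩
    norm X               ≡⟨ norm-idem nX ⟩
    X                    ∎
    where
    open ≡-Reasoning
    open DivMod (divMod-B X) renaming (quotient to q; remainder to r)
    r≡[] = ∣⇒remainder≡[] nB remainder-NF (subst (B ∣_) (sym (norm-idem nX)) B∣X) division remainder-<

  quot-unique : ∀ {X c} → NF X → NF c → B *P c ≡ X → quot X ≡ c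
  quot-unique {X} {c} nX nc Bc≡X =
    *P-cancelˡ nB B≢[] (quot-NF X) nc (trans (quot-exact nX (divides c nc Bc≡X)) (sym Bc≡X))

  divides? : ∀ {X} → NF X → Dec (B ∣ X)
  divides? {X} nX with divMod′ nX nB B≢[]
  ... | divMod q [] nq _ division _ =
    yes (divides q nq (sym (trans division (trans (+P-identityʳ (B *P q)) (norm-idem (*P-NF B q))))))
  ... | divMod q r@(_ ∷ _) _ nr division r<B = no λ B∣X → case ∣⇒remainder≡[] nB nr B∣X division r<B of λ ()

record Bézout (a b : Poly) : Set where
  constructor bézout
  field
    d u v : Poly
    d-NF : NF d
    d∣a : d ∣ a
    d∣b : d ∣ b
    identity : d ≡ (u *P a) +P (v *P b)

-- Euclid's algorithm; the fuel n bounds the length of b.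
bézout-fuel : ∀ n {a b} → NF a → NF b → length b ≤ n → Bézout a b
bézout-fuel n {a} {[]} na _ _ =
  bézout a oneP [] na (divides oneP oneP-NF (*P-identityʳ na)) (divides [] nf[] (*P-zeroʳ a))
    (sym (trans (+P-identityʳ (oneP *P a)) (trans (norm-norm (mulRaw oneP a)) (trans (*P-identityˡ a) (norm-idem na)))))
bézout-fuel zero {b = _ ∷ _} _ _ ()
bézout-fuel (suc n) {a} {b@(_ ∷ _)} na nb b≤n =
  bézout d v (u +P v *P q) d-NF (divides (c₁ *P q +P c₂) (+P-NF (c₁ *P q) c₂) d[c₁q+c₂]≡a) d∣b identity′
  where
  open DivMod (divMod′ na nb (λ ())) renaming (quotient to q; remainder to r; remainder-NF to nr)
  open Bézout (bézout-fuel n nb nr (≤-pred (≤-trans remainder-< b≤n))) renaming (d∣a to d∣b; d∣b to d∣r)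
  open _∣_ d∣b renaming (cofactor to c₁; equation to dc₁≡b)
  open _∣_ d∣r renaming (cofactor to c₂; equation to dc₂≡r)
  d[c₁q+c₂]≡a : d *P (c₁ *P q +P c₂) ≡ a
  d[c₁q+c₂]≡a = begin
    d *P (c₁ *P q +P c₂)            ≡⟨ ≈N⇒≡ (*P-NF d (c₁ *P q +P c₂)) (+P-NF ((d *P c₁) *P q) (d *P c₂))
                                         (solve 4 (λ d c₁ q c₂ → d :* (c₁ :* q :+ c₂) := (d :* c₁) :* q :+ d :* c₂)
                                           (mk≈N refl) d c₁ q c₂) ⟩
    (d *P c₁) *P q +P d *P c₂       ≡⟨ cong₂ (λ x y → x *P q +P y) dc₁≡b dc₂≡r ⟩
    b *P q +P r                     ≡⟨ sym division ⟩
    a                               ∎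
    where open ≡-Reasoning
  identity′ : d ≡ v *P a +P (u +P v *P q) *P b
  identity′ = begin
    d                               ≡⟨ identity ⟩
    u *P b +P v *P r                ≡⟨ ≈N⇒≡ (+P-NF (u *P b) (v *P r)) (+P-NF (v *P (b *P q +P r)) ((u +P v *P q) *P b))
                                         (solve 5 (λ u v b q r → u :* b :+ v :* r := v :* (b :* q :+ r) :+ (u :+ v :* q) :* b)
                                           (mk≈N refl) u v b q r) ⟩
    v *P (b *P q +P r) +P (u +P v *P q) *P b  ≡⟨ cong (λ x → v *P x +P (u +P v *P q) *P b) (sym division) ⟩
    v *P a +P (u +P v *P q) *P b    ∎
    where open ≡-Reasoning

bézout′ : ∀ {a b} → NF a → NF b → Bézout a b
bézout′ {b = b} na nb = bézout-fuel (length b) na nb ≤-refl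

record Irreducible (P : Poly) : Set where
  field
    normal : NF P
    nonconstant : 2 ≤ length P
    trivial-divisors : ∀ {D} → NF D → D ∣ P → D ≡ oneP ⊎ D ≡ P
open Irreducible

irreducible-≢[] : ∀ {P} → Irreducible P → P ≢ []
irreducible-≢[] iP refl with () ← nonconstant iP

irreducible-≢1 : ∀ {P} → Irreducible P → P ≢ oneP
irreducible-≢1 iP refl with s≤s () ← nonconstant iP

euclid : ∀ {P F G} → Irreducible P → NF F → NF G → P ∣ F *P G → ¬ (P ∣ G) → P ∣ F
euclid {P} {F} {G} iP nF nG (divides c _ Pc≡FG) P∤G with bézout′ (normal iP) nG
... | bézout d u v nd d∣P d∣G d≡uP+vG with trivial-divisors iP nd d∣P
...   | inj₂ refl = ⊥-elim (P∤G d∣G)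
...   | inj₁ d≡1 = divides (F *P u +P v *P c) (+P-NF (F *P u) (v *P c)) (sym F≡P[Fu+vc])
  where
  F≡P[Fu+vc] : F ≡ P *P (F *P u +P v *P c)
  F≡P[Fu+vc] = begin
    F                              ≡⟨ sym (*P-identityʳ nF) ⟩
    F *P oneP                      ≡⟨ cong (F *P_) (trans (sym d≡1) d≡uP+vG) ⟩
    F *P (u *P P +P v *P G)        ≡⟨ ≈N⇒≡ (*P-NF F (u *P P +P v *P G)) (+P-NF (P *P (F *P u)) (v *P (F *P G)))
                                        (solve 5 (λ f u p v g → f :* (u :* p :+ v :* g) := p :* (f :* u) :+ v :* (f :* g))
                                          (mk≈N refl) F u P v G) ⟩
    P *P (F *P u) +P v *P (F *P G) ≡⟨ cong (λ x → P *P (F *P u) +P v *P x) (sym Pc≡FG) ⟩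
    P *P (F *P u) +P v *P (P *P c) ≡⟨ ≈N⇒≡ (+P-NF (P *P (F *P u)) (v *P (P *P c))) (*P-NF P (F *P u +P v *P c))
                                        (solve 5 (λ p f u c v → p :* (f :* u) :+ v :* (p :* c) := p :* (f :* u :+ v :* c))
                                          (mk≈N refl) P F u c v) ⟩
    P *P (F *P u +P v *P c)        ∎
    where open ≡-Reasoning

∣-refl : ∀ {D} → NF D → D ∣ D
∣-refl nD = divides oneP oneP-NF (*P-identityʳ nD)

∣-trans : ∀ {D E F} → D ∣ E → E ∣ F → D ∣ F
∣-trans {D} (divides c nc Dc≡E) (divides c' _ Ec'≡F) =
  divides (c *P c') (*P-NF c c') (trans (sym (*P-assoc D c c')) (trans (cong (_*P c') Dc≡E) Ec'≡F))

∣-≢[] : ∀ {D M} → M ≢ [] → D ∣ M → D ≢ []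
∣-≢[] M≢[] (divides c _ Dc≡M) refl = M≢[] (sym Dc≡M)

cofactor-≢[] : ∀ {D M} → M ≢ [] → (d : D ∣ M) → cofactor d ≢ []
cofactor-≢[] {D} M≢[] d e = M≢[] (trans (sym (equation d)) (trans (cong (D *P_) e) (*P-zeroʳ D)))

∈-concatMap⁺′ : ∀ {A B : Set} (f : A → List B) {x xs y} → x ∈ xs → y ∈ f x → y ∈ concatMap f xs
∈-concatMap⁺′ f x∈xs y∈fx = ∈-concatMap⁺ f (lose x∈xs y∈fx)

∈-concatMap⁻′ : ∀ {A B : Set} (f : A → List B) xs {y} → y ∈ concatMap f xs → Σ A λ x → x ∈ xs × y ∈ f x
∈-concatMap⁻′ f xs y∈ = find (∈-concatMap⁻ f {xs = xs} y∈)

concatMap-Unique : ∀ {A B : Set} (f : A → List B) {xs} → Unique xs → (∀ {x} → x ∈ xs → Unique (f x)) →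
                   (∀ {x y z} → x ∈ xs → y ∈ xs → z ∈ f x → z ∈ f y → x ≡ y) → Unique (concatMap f xs)
concatMap-Unique f {[]} _ _ _ = []
concatMap-Unique f {x ∷ xs} (x∉xs ∷ u) u-f disjoint =
  Unique.++⁺ (u-f (here refl)) (concatMap-Unique f u (u-f ∘ there) (λ a b → disjoint (there a) (there b)))
    λ (z∈fx , z∈rest) → case ∈-concatMap⁻′ f xs z∈rest of
      λ (y , y∈xs , z∈fy) → All.lookup x∉xs y∈xs (disjoint (here refl) (there y∈xs) z∈fx z∈fy)

∈-filterᵇ⁺ : ∀ {A : Set} (p : A → Bool) {x xs} → x ∈ xs → T (p x) → x ∈ filterᵇ p xs
∈-filterᵇ⁺ p = ∈-filter⁺ (T? ∘ p)

∈-filterᵇ⁻ : ∀ {A : Set} (p : A → Bool) {x} xs → x ∈ filterᵇ p xs → x ∈ xs × T (p x)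
∈-filterᵇ⁻ p xs = ∈-filter⁻ (T? ∘ p) {xs = xs}

filterᵇ-Unique : ∀ {A : Set} (p : A → Bool) {xs} → Unique xs → Unique (filterᵇ p xs)
filterᵇ-Unique p = Unique.filter⁺ (T? ∘ p)

==⇒≡ : ∀ {p q} → T (p == q) → p ≡ q
==⇒≡ = toWitness

≡⇒== : ∀ {p q} → p ≡ q → T (p == q)
≡⇒== = fromWitness

≢⇒not-== : ∀ {p q} → p ≢ q → T (not (p == q))
≢⇒not-== = fromWitnessFalse

∈-allBL : ∀ l → l ∈ allBL (length l)
∈-allBL [] = here refl
∈-allBL (false ∷ l) = ∈-concatMap⁺′ _ (∈-allBL l) (here refl)
∈-allBL (true ∷ l) = ∈-concatMap⁺′ _ (∈-allBL l) (there (here refl))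

∈-allBL⇒length : ∀ k {l} → l ∈ allBL k → length l ≡ k
∈-allBL⇒length zero (here refl) = refl
∈-allBL⇒length (suc k) l∈ with ∈-concatMap⁻′ _ (allBL k) l∈
... | _ , l'∈ , here refl = cong suc (∈-allBL⇒length k l'∈)
... | _ , l'∈ , there (here refl) = cong suc (∈-allBL⇒length k l'∈)

allBL-Unique : ∀ k → Unique (allBL k)
allBL-Unique zero = All.[] ∷ []
allBL-Unique (suc k) = concatMap-Unique _ (allBL-Unique k) (λ _ → ((λ ()) All.∷ All.[]) ∷ All.[] ∷ [])
  λ { _ _ (here refl) (here refl) → refl ; _ _ (there (here refl)) (there (here refl)) → refl
    ; _ _ (here refl) (there (here ())) ; _ _ (there (here refl)) (here ()) }

ofLength : ℕ → List Poly
ofLength k = map (_++ [ true ]) (allBL k)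

∷ʳ-true-NF : ∀ l → NF (l ++ [ true ])
∷ʳ-true-NF [] = oneP-NF
∷ʳ-true-NF (a ∷ l) = nf∷ a (∷ʳ-true-NF l) (⊥-elim ∘ ++-[true]-≢[] l)

Normal⇒NF : ∀ {A} → Normal A → NF A
Normal⇒NF nil = nf[]
Normal⇒NF (lead xs) = ∷ʳ-true-NF xs

NF⇒∷ʳ-true : ∀ {p} → NF p → p ≢ [] → Σ Poly λ l → p ≡ l ++ [ true ]
NF⇒∷ʳ-true nf[] p≢[] = ⊥-elim (p≢[] refl)
NF⇒∷ʳ-true (nf∷ a {[]} _ a≡true) _ rewrite a≡true refl = [] , refl
NF⇒∷ʳ-true (nf∷ a {_ ∷ _} np _) _ with NF⇒∷ʳ-true np (λ ())
... | l , e = a ∷ l , cong (a ∷_) e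

length-∷ʳ-true : ∀ (l : Poly) → length (l ++ [ true ]) ≡ suc (length l)
length-∷ʳ-true l = trans (length-++ l) (+-comm (length l) 1)

∈-polysUpTo⁺ : ∀ n {p} → NF p → length p ≤ n → p ∈ polysUpTo n
∈-polysUpTo⁺ n {[]} _ _ = here refl
∈-polysUpTo⁺ n {p@(_ ∷ _)} np p≤n with NF⇒∷ʳ-true np (λ ())
... | l , e = subst (_∈ polysUpTo n) (sym e)
  (there (∈-concatMap⁺′ ofLength (∈-upTo⁺ (subst (_≤ n) (trans (cong length e) (length-∷ʳ-true l)) p≤n))
                                 (∈-map⁺ (_++ [ true ]) (∈-allBL l))))

∈-polysUpTo⁻ : ∀ n {p} → p ∈ polysUpTo n → NF p × length p ≤ n
∈-polysUpTo⁻ n (here refl) = nf[] , z≤n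
∈-polysUpTo⁻ n (there p∈) with ∈-concatMap⁻′ ofLength (upTo n) p∈
... | k , k∈ , p∈′ with ∈-map⁻ (_++ [ true ]) p∈′
... | l , l∈ , refl =
  ∷ʳ-true-NF l , subst (_≤ n) (sym (trans (length-∷ʳ-true l) (cong suc (∈-allBL⇒length k l∈))))
                                            (∈-upTo⁻ k∈)

polysUpTo-Unique : ∀ n → Unique (polysUpTo n)
polysUpTo-Unique n =
  All.tabulate (λ p∈ []≡p → ++-[true]-≢[] _ (sym (trans []≡p (proj₂ (lastTrue p∈)))))
    ∷ concatMap-Unique ofLength (Unique.upTo⁺ n)
        (λ {k} _ → Unique.map⁺ (λ {x} {y} → ++-cancelʳ [ true ] x y) (allBL-Unique k)) same-length
  where
  lastTrue : ∀ {p} → p ∈ concatMap ofLength (upTo n) → Σ Poly λ l → p ≡ l ++ [ true ]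
  lastTrue p∈ with ∈-concatMap⁻′ ofLength (upTo n) p∈
  ... | _ , _ , p∈′ with ∈-map⁻ (_++ [ true ]) p∈′
  ... | l , _ , e = l , e
  same-length : ∀ {j k p} → j ∈ upTo n → k ∈ upTo n → p ∈ ofLength j → p ∈ ofLength k → j ≡ k
  same-length {j} {k} _ _ p∈j p∈k with ∈-map⁻ (_++ [ true ]) p∈j | ∈-map⁻ (_++ [ true ]) p∈k
  ... | l , l∈ , refl | l' , l'∈ , e = begin
    j                     ≡⟨ sym (∈-allBL⇒length j l∈) ⟩
    length l              ≡⟨ suc-injective (trans (sym (length-∷ʳ-true l))
                                                  (trans (cong length e) (length-∷ʳ-true l'))) ⟩
    length l'             ≡⟨ ∈-allBL⇒length k l'∈ ⟩
    k                     ∎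
    where open ≡-Reasoning

cofactors : Poly → Poly → List (Poly × Poly)
cofactors A D = map (D ,_) (filterᵇ (λ Q → (D *P Q) == A) (polysUpTo (length A)))

∈-divPairs⁻ : ∀ {A D Q} → (D , Q) ∈ divPairs A → NF D × NF Q × D *P Q ≡ A
∈-divPairs⁻ {A} DQ∈ with ∈-concatMap⁻′ (cofactors A) (polysUpTo (length A)) DQ∈
... | D , D∈ , DQ∈′ with ∈-map⁻ (D ,_) DQ∈′
... | Q , Q∈ , refl with ∈-filterᵇ⁻ (λ Q → (D *P Q) == A) (polysUpTo (length A)) Q∈
... | Q∈′ , DQ==A =
  proj₁ (∈-polysUpTo⁻ (length A) D∈) , proj₁ (∈-polysUpTo⁻ (length A) Q∈′) , ==⇒≡ DQ==A

∈-divPairs⁺ : ∀ {A D Q} → A ≢ [] → NF D → NF Q → D *P Q ≡ A → (D , Q) ∈ divPairs A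
∈-divPairs⁺ {A} {D} {Q} A≢[] nD nQ DQ≡A =
  ∈-concatMap⁺′ (cofactors A) (∈-polysUpTo⁺ (length A) nD (proj₁ lengths))
    (∈-map⁺ (D ,_) (∈-filterᵇ⁺ (λ Q → (D *P Q) == A) (∈-polysUpTo⁺ (length A) nQ (proj₂ lengths)) (≡⇒== DQ≡A)))
  where
  lengths = subst (λ A → length D ≤ length A × length Q ≤ length A) DQ≡A
                  (factor-length nD nQ (λ e → A≢[] (trans (sym DQ≡A) e)))

divPairs-Unique : ∀ A → Unique (divPairs A)
divPairs-Unique A = concatMap-Unique (cofactors A) (polysUpTo-Unique (length A))
  (λ {D} _ → Unique.map⁺ (cong proj₂) (filterᵇ-Unique (λ Q → (D *P Q) == A) (polysUpTo-Unique (length A))))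
  same-divisor
  where
  same-divisor : ∀ {D D' z} → D ∈ polysUpTo (length A) → D' ∈ polysUpTo (length A) →
                 z ∈ cofactors A D → z ∈ cofactors A D' → D ≡ D'
  same-divisor {D} {D'} _ _ z∈ z∈′ with ∈-map⁻ (D ,_) z∈ | ∈-map⁻ (D' ,_) z∈′
  ... | _ , _ , refl | _ , _ , e = cong proj₁ e

dividesᵇ-complete : ∀ {D A} → NF A → A ≢ [] → NF D → D ∣ A → T (dividesᵇ D A)
dividesᵇ-complete {D} {A} nA A≢[] nD (divides c nc Dc≡A) =
  any⁺ (λ Q → (D *P Q) == A) (lose (∈-polysUpTo⁺ (length A) nc c≤A) (≡⇒== Dc≡A))
  where
  c≤A = subst (λ z → length c ≤ length z) Dc≡A (proj₂ (factor-length nD nc (λ e → A≢[] (trans (sym Dc≡A) e))))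

dividesᵇ-sound : ∀ {D A} → T (dividesᵇ D A) → D ∣ A
dividesᵇ-sound {D} {A} t with find (any⁻ (λ Q → (D *P Q) == A) (polysUpTo (length A)) t)
... | Q , Q∈ , DQ==A = divides Q (proj₁ (∈-polysUpTo⁻ (length A) Q∈)) (==⇒≡ DQ==A)

SquareFree : Poly → Set
SquareFree Q = ∀ {R} → NF R → 2 ≤ length R → ¬ (R *P R ∣ Q)

squareFactorᵇ : Poly → Poly → Bool
squareFactorᵇ Q R = (2 ≤ᵇ length R) ∧ dividesᵇ (R *P R) Q

squarefreeᵇ-sound : ∀ {Q} → NF Q → Q ≢ [] → T (squarefreeᵇ Q) → SquareFree Q
squarefreeᵇ-sound {Q} nQ Q≢[] sf {R} nR 2≤R RR∣Q
  with any (squareFactorᵇ Q) (polysUpTo (length Q)) | any⁺ (squareFactorᵇ Q) (lose R∈ isSquareFactor)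
  where
  RR≢[] = ∣-≢[] Q≢[] RR∣Q
  R∈ : R ∈ polysUpTo (length Q)
  R∈ = ∈-polysUpTo⁺ (length Q) nR (≤-trans (proj₁ (factor-length nR nR RR≢[]))
         (subst (λ z → length (R *P R) ≤ length z) (equation RR∣Q)
           (proj₁ (factor-length (*P-NF R R) (cofactor-NF RR∣Q) (subst (_≢ []) (sym (equation RR∣Q)) Q≢[])))))
  isSquareFactor : T (squareFactorᵇ Q R)
  isSquareFactor = Equivalence.from T-∧ (≤⇒≤ᵇ 2≤R , dividesᵇ-complete nQ Q≢[] (*P-NF R R) RR∣Q)
squarefreeᵇ-sound _ _ () _ _ _ | true | _

squarefreeᵇ-complete : ∀ {Q} → SquareFree Q → T (squarefreeᵇ Q)
squarefreeᵇ-complete {Q} sf with any (squareFactorᵇ Q) (polysUpTo (length Q)) in eq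
... | false = _
... | true with find (any⁻ (squareFactorᵇ Q) (polysUpTo (length Q)) (subst T (sym eq) _))
... | R , R∈ , isSquareFactor with Equivalence.to T-∧ isSquareFactor
... | 2≤R , RR∣Q =
  ⊥-elim (sf (proj₁ (∈-polysUpTo⁻ (length Q) R∈)) (≤ᵇ⇒≤ 2 (length R) 2≤R) (dividesᵇ-sound RR∣Q))

sumP-NF : ∀ l → NF (sumP l)
sumP-NF [] = nf[]
sumP-NF (x ∷ l) = +P-NF x (sumP l)

≈N-setoid : Setoid _ _
≈N-setoid = record { isEquivalence = ≈N-isEquivalence }

sumP-↭ : ∀ {xs ys} → xs ↭ ys → sumP xs ≡ sumP ys
sumP-↭ {xs} {ys} xs↭ys = ≈N⇒≡ (sumP-NF xs) (sumP-NF ys)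
  (PermutationProperties.foldr-commMonoid ≈N-setoid
    (IsCommutativeSemiring.+-isCommutativeMonoid +P-*P-isCommutativeSemiring) (↭⇒↭ₛ′ ≈N-isEquivalence xs↭ys))

same-members⇒↭ : ∀ {X : Set} {xs ys : List X} → Unique xs → Unique ys →
                 (∀ {x} → x ∈ xs → x ∈ ys) → (∀ {x} → x ∈ ys → x ∈ xs) → xs ↭ ys
same-members⇒↭ uxs uys to from = ∼bag⇒↭ (unique∧set⇒bag uxs uys (mk⇔ to from))

sumP-++ : ∀ l l' → sumP (l ++ l') ≡ sumP l +P sumP l'
sumP-++ [] l' = sym (norm-idem (sumP-NF l'))
sumP-++ (x ∷ l) l' = trans (cong (x +P_) (sumP-++ l l')) (sym (+P-assoc x (sumP l) (sumP l')))

sumP-concatMap : ∀ {X : Set} (g : X → List Poly) l → sumP (map (sumP ∘ g) l) ≡ sumP (concatMap g l)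
sumP-concatMap g [] = refl
sumP-concatMap g (x ∷ l) = trans (cong (sumP (g x) +P_) (sumP-concatMap g l)) (sym (sumP-++ (g x) (concatMap g l)))

sumP-≡[] : ∀ {X : Set} (h : X → Poly) l → (∀ {x} → x ∈ l → h x ≡ []) → sumP (map h l) ≡ []
sumP-≡[] h [] _ = refl
sumP-≡[] h (x ∷ l) h≡[] rewrite h≡[] (here refl) | sumP-≡[] h l (h≡[] ∘ there) = refl

sumP-single : ∀ {X : Set} (h : X → Poly) {l x₀} → Unique l → x₀ ∈ l →
              (∀ {x} → x ∈ l → x ≢ x₀ → h x ≡ []) → sumP (map h l) ≡ norm (h x₀)
sumP-single h {x ∷ l} (x∉l ∷ _) (here refl) h≡[] =
  trans (cong (h x +P_) (sumP-≡[] h l (λ y∈l → h≡[] (there y∈l) (All.lookup x∉l y∈l ∘ sym))))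
        (+P-identityʳ (h x))
sumP-single h {x ∷ l} (x∉l ∷ u) (there x₀∈l) h≡[] =
  trans (cong (_+P sumP (map h l)) (h≡[] (here refl) (All.lookup x∉l x₀∈l)))
        (trans (norm-idem (sumP-NF (map h l))) (sumP-single h u x₀∈l (h≡[] ∘ there)))

data Even : ℕ → Set where
  even-zero : Even 0
  even-suc-suc : ∀ {n} → Even n → Even (suc (suc n))

sumP-const-Even : ∀ {X : Set} (E : Poly) (l : List X) → Even (length l) → sumP (map (λ _ → E) l) ≡ []
sumP-const-Even E [] even-zero = refl
sumP-const-Even E (_ ∷ _ ∷ l) (even-suc-suc even) = begin
  E +P (E +P sumP (map (λ _ → E) l))   ≡⟨ sym (+P-assoc E E _) ⟩
  (E +P E) +P sumP (map (λ _ → E) l)   ≡⟨ cong (_+P sumP (map (λ _ → E) l)) (+P-self E) ⟩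
  norm (sumP (map (λ _ → E) l))        ≡⟨ cong norm (sumP-const-Even E l even) ⟩
  []                                   ∎
  where open ≡-Reasoning

record FixpointFreeInvolution {X : Set} (ι : X → X) (l : List X) : Set where
  field
    closed : ∀ {x} → x ∈ l → ι x ∈ l
    involutive : ∀ {x} → x ∈ l → ι (ι x) ≡ x
    fixpoint-free : ∀ {x} → x ∈ l → ι x ≢ x

-- The members of l fall into the pairs {x , ι x}; remove one pair and recurse.
involution⇒Even-fuel : ∀ {X : Set} {ι : X → X} n (l : List X) → length l ≤ n → Unique l →
                       FixpointFreeInvolution ι l → Even (length l)
involution⇒Even-fuel _ [] _ _ _ = even-zero
involution⇒Even-fuel zero (_ ∷ _) () _ _
involution⇒Even-fuel {X} {ι} (suc n) (x ∷ l₁) (s≤s l₁≤n) u inv with FixpointFreeInvolution.closed inv (here refl)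
... | here ιx≡x = ⊥-elim (FixpointFreeInvolution.fixpoint-free inv (here refl) ιx≡x)
... | there ιx∈l₁ with ∈-∃++ ιx∈l₁
... | pre , post , refl = subst Even (sym length-l) (even-suc-suc
        (involution⇒Even-fuel n rest rest≤n u-rest (record { closed = closed′ ; involutive = involutive ∘ from-rest
                                                            ; fixpoint-free = fixpoint-free ∘ from-rest })))
  where
  open FixpointFreeInvolution inv
  rest = pre ++ post
  l↭ : x ∷ pre ++ [ ι x ] ++ post ↭ x ∷ ι x ∷ rest
  l↭ = ↭-prep x (shift (ι x) pre post)
  length-l : length (x ∷ pre ++ [ ι x ] ++ post) ≡ suc (suc (length rest))
  length-l = ↭-length l↭
  rest≤n : length rest ≤ n
  rest≤n = ≤-trans (n≤1+n _) (≤-trans (≤-reflexive (sym (suc-injective length-l))) l₁≤n)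
  u-all : Unique (x ∷ ι x ∷ rest)
  u-all = PermutationProperties.Unique-resp-↭ (setoid X) (↭⇒↭ₛ l↭) u
  u-rest : Unique rest
  u-rest with _ ∷ _ ∷ u′ ← u-all = u′
  x∉rest : ∀ {y} → y ∈ rest → x ≢ y
  x∉rest y∈ with x∉ ∷ _ ← u-all = All.lookup x∉ (there y∈)
  ιx∉rest : ∀ {y} → y ∈ rest → ι x ≢ y
  ιx∉rest y∈ with _ ∷ ιx∉ ∷ _ ← u-all = All.lookup ιx∉ y∈
  from-rest : ∀ {y} → y ∈ rest → y ∈ x ∷ pre ++ [ ι x ] ++ post
  from-rest y∈ = ∈-resp-↭ (↭-sym l↭) (there (there y∈))
  closed′ : ∀ {y} → y ∈ rest → ι y ∈ rest
  closed′ {y} y∈ with ∈-resp-↭ l↭ (closed (from-rest y∈))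
  ... | here ιy≡x = ⊥-elim (ιx∉rest y∈ (trans (cong ι (sym ιy≡x)) (involutive (from-rest y∈))))
  ... | there (here ιy≡ιx) =
    ⊥-elim (x∉rest y∈ (trans (sym (involutive (here refl)))
                             (trans (cong ι (sym ιy≡ιx)) (involutive (from-rest y∈)))))
  ... | there (there ιy∈) = ιy∈

involution⇒Even : ∀ {X : Set} {ι : X → X} {l : List X} → Unique l → FixpointFreeInvolution ι l → Even (length l)
involution⇒Even {l = l} = involution⇒Even-fuel (length l) l ≤-refl

-- Irreducible factors and square-free polynomials

2≤length : ∀ {D} → NF D → D ≢ [] → D ≢ oneP → 2 ≤ length D
2≤length {[]} _ D≢[] _ = ⊥-elim (D≢[] refl)
2≤length {a ∷ []} (nf∷ _ _ a≡true) _ D≢1 = ⊥-elim (D≢1 (cong (_∷ []) (a≡true refl)))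
2≤length {_ ∷ _ ∷ _} _ _ _ = s≤s (s≤s z≤n)

proper-divisor-shorter : ∀ {D M} → NF D → M ≢ [] → D ∣ M → D ≢ M → length D < length M
proper-divisor-shorter {D} {M} nD M≢[] (divides c nc Dc≡M) D≢M = +-cancelʳ-≤ 1 (suc (length D)) (length M) (begin
    suc (length D) + 1    ≡⟨ +-comm (suc (length D)) 1 ⟩
    2 + length D          ≡⟨ +-comm 2 (length D) ⟩
    length D + 2          ≤⟨ +-monoʳ-≤ (length D) (2≤length nc c≢[] c≢1) ⟩
    length D + length c   ≡⟨ sym (*P-length nD nc (∣-≢[] M≢[] (divides c nc Dc≡M)) c≢[]) ⟩
    suc (length (D *P c)) ≡⟨ cong (suc ∘ length) Dc≡M ⟩
    suc (length M)        ≡⟨ +-comm 1 (length M) ⟩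
    length M + 1          ∎)
  where
  open ≤-Reasoning
  c≢[] : c ≢ []
  c≢[] = cofactor-≢[] {D} M≢[] (divides c nc Dc≡M)
  c≢1 : c ≢ oneP
  c≢1 refl = D≢M (trans (sym (*P-identityʳ nD)) Dc≡M)

_≟P_ : (p q : Poly) → Dec (p ≡ q)
_≟P_ = ≡-dec _≟B_

module _ {M : Poly} (nM : NF M) (M≢[] : M ≢ []) where

  ProperDivisor : Poly → Set
  ProperDivisor D = T (dividesᵇ D M) × D ≢ oneP × D ≢ M

  proper-divisor? : ∀ D → Dec (ProperDivisor D)
  proper-divisor? D = T? (dividesᵇ D M) ×-dec ¬? (D ≟P oneP) ×-dec ¬? (D ≟P M)

  no-proper-divisor⇒irreducible : M ≢ oneP → ¬ Any ProperDivisor (polysUpTo (length M)) → Irreducible M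
  no-proper-divisor⇒irreducible M≢1 none = record
    { normal = nM ; nonconstant = 2≤length nM M≢[] M≢1 ; trivial-divisors = trivial }
    where
    trivial : ∀ {D} → NF D → D ∣ M → D ≡ oneP ⊎ D ≡ M
    trivial {D} nD D∣M with D ≟P oneP | D ≟P M
    ... | yes D≡1 | _ = inj₁ D≡1
    ... | no _ | yes D≡M = inj₂ D≡M
    ... | no D≢1 | no D≢M = ⊥-elim (none (lose D∈ (dividesᵇ-complete nM M≢[] nD D∣M , D≢1 , D≢M)))
      where
      D∈ = ∈-polysUpTo⁺ (length M) nD (<⇒≤ (proper-divisor-shorter nD M≢[] D∣M D≢M))

irreducible-factor-fuel : ∀ n {M} → NF M → M ≢ [] → M ≢ oneP → length M ≤ n →
                          Σ Poly λ T → Irreducible T × T ∣ M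
irreducible-factor-fuel n {M} nM M≢[] M≢1 M≤n with any? (proper-divisor? nM M≢[]) (polysUpTo (length M))
... | no none = M , no-proper-divisor⇒irreducible nM M≢[] M≢1 none , ∣-refl nM
irreducible-factor-fuel zero _ M≢[] _ M≤0 | yes _ = case ≤-trans (length-≢[] M≢[]) M≤0 of λ ()
irreducible-factor-fuel (suc n) {M} nM M≢[] _ M≤n | yes some with find some
... | D , D∈ , D∣ᵇM , D≢1 , D≢M with irreducible-factor-fuel n nD (∣-≢[] M≢[] D∣M) D≢1 D≤n
  where
  nD = proj₁ (∈-polysUpTo⁻ (length M) D∈)
  D∣M = dividesᵇ-sound D∣ᵇM
  D≤n = ≤-pred (≤-trans (proper-divisor-shorter nD M≢[] D∣M D≢M) M≤n)
... | T , iT , T∣D = T , iT , ∣-trans T∣D (dividesᵇ-sound D∣ᵇM)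

irreducible-factor : ∀ {M} → NF M → M ≢ [] → M ≢ oneP → Σ Poly λ T → Irreducible T × T ∣ M
irreducible-factor {M} nM M≢[] M≢1 = irreducible-factor-fuel (length M) nM M≢[] M≢1 ≤-refl

∣-*P-mono : ∀ {A B C D} → A ∣ B → C ∣ D → A *P C ∣ B *P D
∣-*P-mono {A} {B} {C} {D} (divides b nb Ab≡B) (divides d nd Cd≡D) = divides (b *P d) (*P-NF b d) (begin
  (A *P C) *P (b *P d)   ≡⟨ ≈N⇒≡ (*P-NF (A *P C) (b *P d)) (*P-NF (A *P b) (C *P d))
                              (solve 4 (λ a c b d → (a :* c) :* (b :* d) := (a :* b) :* (c :* d)) (mk≈N refl) A C b d) ⟩
  (A *P b) *P (C *P d)   ≡⟨ cong₂ _*P_ Ab≡B Cd≡D ⟩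
  B *P D                 ∎)
  where open ≡-Reasoning

SquareFree-∣ : ∀ {D A} → SquareFree A → D ∣ A → SquareFree D
SquareFree-∣ sfA D∣A nR 2≤R RR∣D = sfA nR 2≤R (∣-trans RR∣D D∣A)

irreducible-∤-cofactor : ∀ {P Q} → Irreducible P → SquareFree (P *P Q) → ¬ (P ∣ Q)
irreducible-∤-cofactor {P} iP sf (divides c nc Pc≡Q) =
  sf (normal iP) (nonconstant iP) (divides c nc (trans (*P-assoc P P c) (cong (P *P_) Pc≡Q)))

-- Euclid's lemma, twice.
irreducible-square-∣ : ∀ {T P Q} → Irreducible T → Irreducible P → NF Q → ¬ (P ∣ Q) →
                       T *P T ∣ P *P Q → T *P T ∣ Q
irreducible-square-∣ {T} {P} {Q} iT iP nQ P∤Q (divides X nX TTX≡PQ)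
  with ExactDivision.divides? (normal iT) (irreducible-≢[] iT) (normal iP)
... | yes T∣P with trivial-divisors iP (normal iT) T∣P
...   | inj₁ T≡1 = ⊥-elim (irreducible-≢1 iT T≡1)
...   | inj₂ refl = ⊥-elim (P∤Q (divides X nX (*P-cancelˡ nT T≢[] (*P-NF T X) nQ T[TX]≡TQ)))
  where
  nT = normal iT
  T≢[] = irreducible-≢[] iT
  T[TX]≡TQ = trans (sym (*P-assoc T T X)) TTX≡PQ
irreducible-square-∣ {T} {P} {Q} iT iP nQ P∤Q (divides X nX TTX≡PQ) | no T∤P =
  divides Q₂ nQ₂ (trans (*P-assoc T T Q₂) (trans (cong (T *P_) TQ₂≡Q₁) TQ₁≡Q))
  where
  nT = normal iT
  T≢[] = irreducible-≢[] iT
  T[TX]≡QP : T *P (T *P X) ≡ Q *P P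
  T[TX]≡QP = trans (sym (*P-assoc T T X)) (trans TTX≡PQ (*P-comm P Q))
  open _∣_ (euclid iT nQ (normal iP) (divides (T *P X) (*P-NF T X) T[TX]≡QP) T∤P)
    renaming (cofactor to Q₁; cofactor-NF to nQ₁; equation to TQ₁≡Q)
  TX≡Q₁P : T *P X ≡ Q₁ *P P
  TX≡Q₁P = *P-cancelˡ nT T≢[] (*P-NF T X) (*P-NF Q₁ P) (begin
    T *P (T *P X)    ≡⟨ T[TX]≡QP ⟩
    Q *P P           ≡⟨ cong (_*P P) (sym TQ₁≡Q) ⟩
    (T *P Q₁) *P P   ≡⟨ *P-assoc T Q₁ P ⟩
    T *P (Q₁ *P P)   ∎)
    where open ≡-Reasoning
  open _∣_ (euclid iT nQ₁ (normal iP) (divides X nX TX≡Q₁P) T∤P)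
    renaming (cofactor to Q₂; cofactor-NF to nQ₂; equation to TQ₂≡Q₁)

SquareFree-*P-irreducible : ∀ {P Q} → Irreducible P → NF Q → SquareFree Q → ¬ (P ∣ Q) → SquareFree (P *P Q)
SquareFree-*P-irreducible {P} {Q} iP nQ sfQ P∤Q {R} nR 2≤R RR∣PQ
  with irreducible-factor nR (λ { refl → case 2≤R of λ () }) (λ { refl → case 2≤R of λ { (s≤s ()) } })
... | T , iT , T∣R =
  sfQ (normal iT) (nonconstant iT) (irreducible-square-∣ iT iP nQ P∤Q (∣-trans (∣-*P-mono T∣R T∣R) RR∣PQ))

-- Square-free splittings

squareFreeSplittings : Poly → List (Poly × Poly)
squareFreeSplittings M = filterᵇ (squarefreeᵇ ∘ proj₂) (divPairs M)

record SquareFreeSplitting (M F Q : Poly) : Set where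
  constructor splitting
  field
    F-NF : NF F
    Q-NF : NF Q
    product : F *P Q ≡ M
    squareFree : SquareFree Q

∈-squareFreeSplittings⁻ : ∀ {M F Q} → M ≢ [] → (F , Q) ∈ squareFreeSplittings M → SquareFreeSplitting M F Q
∈-squareFreeSplittings⁻ {M} {F} M≢[] FQ∈ with ∈-filterᵇ⁻ (squarefreeᵇ ∘ proj₂) (divPairs M) FQ∈
... | FQ∈′ , sf with ∈-divPairs⁻ FQ∈′
... | nF , nQ , FQ≡M = splitting nF nQ FQ≡M (squarefreeᵇ-sound nQ (cofactor-≢[] {F} M≢[] (divides _ nQ FQ≡M)) sf)

∈-squareFreeSplittings⁺ : ∀ {M F Q} → M ≢ [] → SquareFreeSplitting M F Q → (F , Q) ∈ squareFreeSplittings M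
∈-squareFreeSplittings⁺ M≢[] (splitting nF nQ FQ≡M sfQ) =
  ∈-filterᵇ⁺ (squarefreeᵇ ∘ proj₂) (∈-divPairs⁺ M≢[] nF nQ FQ≡M) (squarefreeᵇ-complete sfQ)

squareFreeSplittings-Unique : ∀ M → Unique (squareFreeSplittings M)
squareFreeSplittings-Unique M = filterᵇ-Unique (squarefreeᵇ ∘ proj₂) (divPairs-Unique M)

-- Moving an irreducible factor P of M between F and Q.
module Toggle {M P : Poly} (M≢[] : M ≢ []) (iP : Irreducible P) (P∣M : P ∣ M) where

  open ExactDivision (normal iP) (irreducible-≢[] iP)
  nP = normal iP

  -- Opaque, so that the conversion checker never unfolds the enumeration inside dividesᵇ.
  opaque
    toggle : Poly × Poly → Poly × Poly
    toggle (F , Q) = if dividesᵇ P Q then (F *P P , quot Q) else (quot F , P *P Q)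

    toggle-∣ : ∀ {F Q} → NF Q → Q ≢ [] → P ∣ Q → toggle (F , Q) ≡ (F *P P , quot Q)
    toggle-∣ {F} {Q} nQ Q≢[] P∣Q with dividesᵇ P Q | dividesᵇ-complete nQ Q≢[] nP P∣Q
    ... | true | _ = refl

    toggle-∤ : ∀ {F Q} → ¬ (P ∣ Q) → toggle (F , Q) ≡ (quot F , P *P Q)
    toggle-∤ {F} {Q} P∤Q with dividesᵇ P Q in eq
    ... | false = refl
    ... | true = ⊥-elim (P∤Q (dividesᵇ-sound (subst T (sym eq) _)))

  private
    Q≢[] : ∀ {F Q} → SquareFreeSplitting M F Q → Q ≢ []
    Q≢[] {F} (splitting _ nQ FQ≡M _) = cofactor-≢[] {F} M≢[] (divides _ nQ FQ≡M)

  module _ {F Q} (s : SquareFreeSplitting M F Q) where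
    open SquareFreeSplitting s renaming (F-NF to nF; Q-NF to nQ; product to FQ≡M; squareFree to sfQ)

    toggle-splitting-∣ : P ∣ Q → SquareFreeSplitting M (F *P P) (quot Q) × ¬ (P ∣ quot Q) ×
                                  toggle (F *P P , quot Q) ≡ (F , Q)
    toggle-splitting-∣ P∣Q = s′ , P∤Q′ , trans (toggle-∤ {F *P P} P∤Q′) (cong₂ _,_ FP/P≡F P[Q/P]≡Q)
      where
      P[Q/P]≡Q = quot-exact nQ P∣Q
      FP/P≡F = quot-unique (*P-NF F P) nF (*P-comm P F)
      s′ : SquareFreeSplitting M (F *P P) (quot Q)
      s′ = splitting (*P-NF F P) (quot-NF Q) (trans (*P-assoc F P (quot Q)) (trans (cong (F *P_) P[Q/P]≡Q) FQ≡M))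
                     (SquareFree-∣ sfQ (divides P nP (trans (*P-comm (quot Q) P) P[Q/P]≡Q)))
      P∤Q′ = irreducible-∤-cofactor iP (subst SquareFree (sym P[Q/P]≡Q) sfQ)

    toggle-splitting-∤ : ¬ (P ∣ Q) → SquareFreeSplitting M (quot F) (P *P Q) × P ∣ P *P Q ×
                                      toggle (quot F , P *P Q) ≡ (F , Q)
    toggle-splitting-∤ P∤Q =
      s′ , P∣PQ , trans (toggle-∣ {quot F} (*P-NF P Q) (Q≢[] s′) P∣PQ) (cong₂ _,_ F/P·P≡F PQ/P≡Q)
      where
      P∣PQ = divides Q nQ refl
      P[F/P]≡F = quot-exact nF (euclid iP nF nQ (subst (P ∣_) (sym FQ≡M) P∣M) P∤Q)
      F/P·P≡F = trans (*P-comm (quot F) P) P[F/P]≡F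
      PQ/P≡Q = quot-unique (*P-NF P Q) nQ refl
      s′ : SquareFreeSplitting M (quot F) (P *P Q)
      s′ = splitting (quot-NF F) (*P-NF P Q)
             (trans (trans (sym (*P-assoc (quot F) P Q)) (cong (_*P Q) F/P·P≡F)) FQ≡M)
             (SquareFree-*P-irreducible iP nQ sfQ P∤Q)

  ToggleStep : Poly × Poly → Set
  ToggleStep x = toggle x ∈ squareFreeSplittings M × toggle (toggle x) ≡ x × toggle x ≢ x

  toggle-step-∣ : ∀ {F Q} → SquareFreeSplitting M F Q → P ∣ Q → ToggleStep (F , Q)
  toggle-step-∣ {F} {Q} s P∣Q =
    subst (_∈ squareFreeSplittings M) (sym e) (∈-squareFreeSplittings⁺ M≢[] s′) , trans (cong toggle e) back ,
    λ fixed → P∤Q′ (subst (P ∣_) (cong proj₂ (trans (sym fixed) e)) P∣Q)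
    where
    e : toggle (F , Q) ≡ (F *P P , quot Q)
    e = toggle-∣ (SquareFreeSplitting.Q-NF s) (Q≢[] s) P∣Q
    r = toggle-splitting-∣ s P∣Q
    s′ = proj₁ r
    P∤Q′ = proj₁ (proj₂ r)
    back = proj₂ (proj₂ r)

  toggle-step-∤ : ∀ {F Q} → SquareFreeSplitting M F Q → ¬ (P ∣ Q) → ToggleStep (F , Q)
  toggle-step-∤ {F} {Q} s P∤Q =
    subst (_∈ squareFreeSplittings M) (sym e) (∈-squareFreeSplittings⁺ M≢[] s′) , trans (cong toggle e) back ,
    λ fixed → P∤Q (subst (P ∣_) (cong proj₂ (trans (sym e) fixed)) P∣Q′)
    where
    e : toggle (F , Q) ≡ (quot F , P *P Q)
    e = toggle-∤ P∤Q
    r = toggle-splitting-∤ s P∤Q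
    s′ = proj₁ r
    P∣Q′ = proj₁ (proj₂ r)
    back = proj₂ (proj₂ r)

  -- toggle changes whether P divides the second component, so it has no fixed points.
  toggle-fixpointFreeInvolution : FixpointFreeInvolution toggle (squareFreeSplittings M)
  toggle-fixpointFreeInvolution = record
    { closed = proj₁ ∘ step ; involutive = proj₁ ∘ proj₂ ∘ step ; fixpoint-free = proj₂ ∘ proj₂ ∘ step }
    where
    step : ∀ {x} → x ∈ squareFreeSplittings M → ToggleStep x
    step {F , Q} x∈ with ∈-squareFreeSplittings⁻ M≢[] x∈
    ... | s with divides? (SquareFreeSplitting.Q-NF s)
    ... | yes P∣Q = toggle-step-∣ s P∣Q
    ... | no P∤Q = toggle-step-∤ s P∤Q

Even-squareFreeSplittings : ∀ {M} → NF M → M ≢ [] → M ≢ oneP → Even (length (squareFreeSplittings M))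
Even-squareFreeSplittings {M} nM M≢[] M≢1 with irreducible-factor nM M≢[] M≢1
... | P , iP , P∣M = involution⇒Even (squareFreeSplittings-Unique M) (Toggle.toggle-fixpointFreeInvolution M≢[] iP P∣M)

-- Exchanging the order of summation

ThreeFactors : Poly → Poly × Poly × Poly → Set
ThreeFactors A (E , F , Q) = NF E × NF F × SquareFreeSplitting A (E *P F) Q

module Fubini {A : Poly} (A≢[] : A ≢ []) where

  private
    D≢[] : ∀ {D Q} → SquareFreeSplitting A D Q → D ≢ []
    D≢[] (splitting _ _ DQ≡A _) refl = A≢[] (sym DQ≡A)

    M≢[] : ∀ {E M} → E *P M ≡ A → M ≢ []
    M≢[] {E} EM≡A refl = A≢[] (trans (sym EM≡A) (*P-zeroʳ E))

  _,,_ : Poly × Poly → Poly → Poly × Poly × Poly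
  (E , F) ,, Q = E , F , Q

  splitDivisor : Poly × Poly → List (Poly × Poly × Poly)
  splitDivisor (D , Q) = map (_,, Q) (divPairs D)

  splitCofactor : Poly × Poly → List (Poly × Poly × Poly)
  splitCofactor (E , M) = map (E ,_) (squareFreeSplittings M)

  byDivisor byCofactor : List (Poly × Poly × Poly)
  byDivisor = concatMap splitDivisor (squareFreeSplittings A)
  byCofactor = concatMap splitCofactor (divPairs A)

  ∈-byDivisor⁻ : ∀ {t} → t ∈ byDivisor → ThreeFactors A t
  ∈-byDivisor⁻ t∈ with ∈-concatMap⁻′ splitDivisor (squareFreeSplittings A) t∈
  ... | (D , Q) , DQ∈ , t∈′ with ∈-map⁻ _ t∈′
  ... | (E , F) , EF∈ , refl with ∈-divPairs⁻ {D} EF∈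
  ... | nE , nF , EF≡D =
    nE , nF , subst (λ D → SquareFreeSplitting A D Q) (sym EF≡D) (∈-squareFreeSplittings⁻ A≢[] DQ∈)

  ∈-byDivisor⁺ : ∀ {t} → ThreeFactors A t → t ∈ byDivisor
  ∈-byDivisor⁺ {E , F , Q} (nE , nF , s) =
    ∈-concatMap⁺′ splitDivisor (∈-squareFreeSplittings⁺ A≢[] s) (∈-map⁺ _ (∈-divPairs⁺ (D≢[] s) nE nF refl))

  ∈-byCofactor⁻ : ∀ {t} → t ∈ byCofactor → ThreeFactors A t
  ∈-byCofactor⁻ t∈ with ∈-concatMap⁻′ splitCofactor (divPairs A) t∈
  ... | (E , M) , EM∈ , t∈′ with ∈-map⁻ _ t∈′
  ... | (F , Q) , FQ∈ , refl with ∈-divPairs⁻ EM∈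
  ... | nE , nM , EM≡A with ∈-squareFreeSplittings⁻ (M≢[] {E} EM≡A) FQ∈
  ... | splitting nF nQ FQ≡M sfQ =
    nE , nF , splitting (*P-NF E F) nQ (trans (*P-assoc E F Q) (trans (cong (E *P_) FQ≡M) EM≡A)) sfQ

  ∈-byCofactor⁺ : ∀ {t} → ThreeFactors A t → t ∈ byCofactor
  ∈-byCofactor⁺ {E , F , Q} (nE , nF , splitting _ nQ EF·Q≡A sfQ) =
    ∈-concatMap⁺′ splitCofactor (∈-divPairs⁺ A≢[] nE (*P-NF F Q) E·FQ≡A)
      (∈-map⁺ _ (∈-squareFreeSplittings⁺ (M≢[] {E} E·FQ≡A) (splitting nF nQ refl sfQ)))
    where
    E·FQ≡A = trans (sym (*P-assoc E F Q)) EF·Q≡A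

  byDivisor-Unique : Unique byDivisor
  byDivisor-Unique = concatMap-Unique splitDivisor (squareFreeSplittings-Unique A)
    (λ {(D , _)} _ → Unique.map⁺ (λ e → cong₂ _,_ (cong proj₁ e) (cong (proj₁ ∘ proj₂) e)) (divPairs-Unique D))
    same-splitting
    where
    same-splitting : ∀ {x y t} → x ∈ squareFreeSplittings A → y ∈ squareFreeSplittings A →
                     t ∈ splitDivisor x → t ∈ splitDivisor y → x ≡ y
    same-splitting {D , Q} {D′ , Q′} _ _ t∈ t∈′ with ∈-map⁻ _ t∈ | ∈-map⁻ _ t∈′
    ... | (E , F) , EF∈ , refl | (E′ , F′) , EF∈′ , refl
      with ∈-divPairs⁻ {D} EF∈ | ∈-divPairs⁻ {D′} EF∈′
    ... | _ , _ , EF≡D | _ , _ , EF≡D′ = cong (_, Q) (trans (sym EF≡D) EF≡D′)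

  byCofactor-Unique : Unique byCofactor
  byCofactor-Unique = concatMap-Unique splitCofactor (divPairs-Unique A)
    (λ {(_ , M)} _ → Unique.map⁺ (cong proj₂) (squareFreeSplittings-Unique M))
    same-pair
    where
    same-pair : ∀ {x y t} → x ∈ divPairs A → y ∈ divPairs A →
                t ∈ splitCofactor x → t ∈ splitCofactor y → x ≡ y
    same-pair {E , M} {E′ , M′} EM∈ EM∈′ t∈ t∈′ with ∈-map⁻ _ t∈ | ∈-map⁻ _ t∈′
    ... | (F , Q) , FQ∈ , refl | _ , FQ∈′ , refl
      with ∈-divPairs⁻ EM∈ | ∈-divPairs⁻ EM∈′
    ... | _ , _ , EM≡A | _ , _ , EM≡A′
      with ∈-squareFreeSplittings⁻ (M≢[] {E} EM≡A) FQ∈ | ∈-squareFreeSplittings⁻ (M≢[] {E} EM≡A′) FQ∈′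
    ... | splitting _ _ FQ≡M _ | splitting _ _ FQ≡M′ _ = cong (E ,_) (trans (sym FQ≡M) FQ≡M′)

  byDivisor↭byCofactor : byDivisor ↭ byCofactor
  byDivisor↭byCofactor = same-members⇒↭ byDivisor-Unique byCofactor-Unique
    (∈-byCofactor⁺ ∘ ∈-byDivisor⁻) (∈-byDivisor⁺ ∘ ∈-byCofactor⁻)

  private
    cofactorCount : Poly × Poly → Poly
    cofactorCount (E , M) = sumP (map (λ _ → E) (squareFreeSplittings M))

    cofactorCount-≡[] : ∀ {y} → y ∈ divPairs A → y ≢ (A , oneP) → cofactorCount y ≡ []
    cofactorCount-≡[] {E , M} y∈ y≢A1 with ∈-divPairs⁻ y∈
    ... | nE , nM , EM≡A = sumP-const-Even E (squareFreeSplittings M) (Even-squareFreeSplittings nM (M≢[] {E} EM≡A) M≢1)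
      where
      M≢1 : M ≢ oneP
      M≢1 refl = y≢A1 (cong (_, oneP) (trans (sym (*P-identityʳ nE)) EM≡A))

  sumσ-squareFreeSplittings : NF A → sumP (map (σ ∘ proj₁) (squareFreeSplittings A)) ≡ A
  sumσ-squareFreeSplittings nA = begin
    sumP (map (σ ∘ proj₁) (squareFreeSplittings A))
      ≡⟨ sumP-concatMap (divisors ∘ proj₁) (squareFreeSplittings A) ⟩
    sumP (concatMap (divisors ∘ proj₁) (squareFreeSplittings A))
      ≡⟨ cong sumP (concatMap-cong (λ (D , Q) → map-∘ {g = proj₁} {f = _,, Q} (divPairs D))
                                   (squareFreeSplittings A)) ⟩
    sumP (concatMap (map proj₁ ∘ splitDivisor) (squareFreeSplittings A))
      ≡⟨ cong sumP (sym (map-concatMap proj₁ splitDivisor (squareFreeSplittings A))) ⟩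
    sumP (map proj₁ byDivisor)
      ≡⟨ sumP-↭ (↭-map⁺ proj₁ byDivisor↭byCofactor) ⟩
    sumP (map proj₁ byCofactor)
      ≡⟨ cong sumP (map-concatMap proj₁ splitCofactor (divPairs A)) ⟩
    sumP (concatMap (map proj₁ ∘ splitCofactor) (divPairs A))
      ≡⟨ cong sumP (concatMap-cong (λ (E , M) → sym (map-∘ {g = proj₁} {f = E ,_} (squareFreeSplittings M)))
                                   (divPairs A)) ⟩
    sumP (concatMap (λ (E , M) → map (λ _ → E) (squareFreeSplittings M)) (divPairs A))
      ≡⟨ sym (sumP-concatMap (λ (E , M) → map (λ _ → E) (squareFreeSplittings M)) (divPairs A)) ⟩
    sumP (map cofactorCount (divPairs A))
      ≡⟨ sumP-single cofactorCount (divPairs-Unique A) (∈-divPairs⁺ A≢[] nA oneP-NF (*P-identityʳ nA))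
                     cofactorCount-≡[] ⟩
    norm (A +P [])
      ≡⟨ trans (norm-norm (addRaw A [])) (trans (+P-identityʳ A) (norm-idem nA)) ⟩
    A ∎
    where open ≡-Reasoning

-- Odd perfect polynomials

coeff-+P : ∀ p q i → coeff (p +P q) i ≡ coeff p i xor coeff q i
coeff-+P p q i = trans (at (norm-≈ (addRaw p q)) i) (coeff-addRaw p q i)

coeff-sumP-Even : ∀ {X : Set} (f : X → Poly) i (l : List X) → Even (length l) →
                  (∀ {x} → x ∈ l → coeff (f x) i ≡ true) → coeff (sumP (map f l)) i ≡ false
coeff-sumP-Even f i [] even-zero _ = refl
coeff-sumP-Even f i (x ∷ y ∷ l) (even-suc-suc even) all-true = begin
  coeff (f x +P (f y +P s)) i                     ≡⟨ coeff-+P (f x) _ i ⟩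
  coeff (f x) i xor coeff (f y +P s) i            ≡⟨ cong (coeff (f x) i xor_) (coeff-+P (f y) s i) ⟩
  coeff (f x) i xor (coeff (f y) i xor coeff s i) ≡⟨ cong₂ (λ a b → a xor (b xor coeff s i))
                                                       (all-true (here refl)) (all-true (there (here refl))) ⟩
  true xor (true xor coeff s i)                   ≡⟨ cong (λ a → true xor (true xor a))
                                                       (coeff-sumP-Even f i l even (all-true ∘ there ∘ there)) ⟩
  false                                           ∎
  where
  open ≡-Reasoning
  s = sumP (map f l)

Odd⇒coeff₀ : ∀ {A D} → Odd A → NF D → D ≢ [] → D ∣ A → coeff D 0 ≡ true
Odd⇒coeff₀ {D = []} _ _ D≢[] _ = ⊥-elim (D≢[] refl)
Odd⇒coeff₀ {D = true ∷ _} _ _ _ _ = refl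
Odd⇒coeff₀ {A} {false ∷ D′} (_ , x∤A , _) nD _ D∣A = ⊥-elim (x∤A (cofactor x∣A , equation x∣A))
  where
  xD′≡D : xP *P D′ ≡ false ∷ D′
  xD′≡D = trans (norm-cong (≈-trans (mulRaw-false∷ oneP D′) (false∷-cong (mulRaw-identityˡ D′)))) (norm-idem nD)
  x∣A : xP ∣ A
  x∣A = ∣-trans {xP} (divides D′ (NF-tail nD) xD′≡D) D∣A

Odd-perfect⇒¬SquareFree : ∀ {A} → NF A → Odd A → Perfect A → A ≢ oneP → ¬ SquareFree A
Odd-perfect⇒¬SquareFree {A} nA odd@(A≢[] , _) perfect A≢1 sfA =
  case trans (sym (Odd⇒coeff₀ odd nA A≢[] (∣-refl nA))) (trans (sym (cong (λ p → coeff p 0) perfect)) σ₀≡false)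
  of λ ()
  where
  all-square-free : All.All (T ∘ squarefreeᵇ ∘ proj₂) (divPairs A)
  all-square-free = All.tabulate λ {(D , Q)} DQ∈ → case ∈-divPairs⁻ DQ∈ of λ (nD , _ , DQ≡A) →
    squarefreeᵇ-complete {Q} (SquareFree-∣ sfA (divides D nD (trans (*P-comm Q D) DQ≡A)))
  even : Even (length (divPairs A))
  even = subst (Even ∘ length) (filter-all (T? ∘ squarefreeᵇ ∘ proj₂) all-square-free)
                (Even-squareFreeSplittings nA A≢[] A≢1)
  σ₀≡false : coeff (σ A) 0 ≡ false
  σ₀≡false = coeff-sumP-Even proj₁ 0 (divPairs A) even λ {(D , Q)} DQ∈ → case ∈-divPairs⁻ DQ∈ of
    λ (nD , nQ , DQ≡A) → Odd⇒coeff₀ odd nD (λ { refl → A≢[] (sym DQ≡A) }) (divides Q nQ DQ≡A)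

properSquareFree : Poly → Poly × Poly → Bool
properSquareFree A (D , Q) = not (D == oneP) ∧ not (D == A) ∧ squarefreeᵇ Q

properSquareFree⇒ : ∀ {A D Q} → T (properSquareFree A (D , Q)) → D ≢ oneP × D ≢ A × T (squarefreeᵇ Q)
properSquareFree⇒ {A} {D} {Q} t with Equivalence.to (T-∧ {not (D == oneP)}) t
... | D≢1 , t′ with Equivalence.to (T-∧ {not (D == A)} {squarefreeᵇ Q}) t′
... | D≢A , sfQ = toWitnessFalse D≢1 , toWitnessFalse D≢A , sfQ

⇒properSquareFree : ∀ {A D Q} → D ≢ oneP → D ≢ A → T (squarefreeᵇ Q) → T (properSquareFree A (D , Q))
⇒properSquareFree {A} {D} {Q} D≢1 D≢A sfQ =
  Equivalence.from (T-∧ {not (D == oneP)})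
    (≢⇒not-== D≢1 , Equivalence.from (T-∧ {not (D == A)} {squarefreeᵇ Q}) (≢⇒not-== D≢A , sfQ))

squareFreeSplittings-↭ : ∀ {A} → NF A → A ≢ [] → ¬ SquareFree A →
                         (A , oneP) ∷ filterᵇ (properSquareFree A) (divPairs A) ↭ squareFreeSplittings A
squareFreeSplittings-↭ {A} nA A≢[] ¬sfA = same-members⇒↭ unique (squareFreeSplittings-Unique A) to from
  where
  proper = filterᵇ (properSquareFree A) (divPairs A)
  A1∉ : ∀ {x} → x ∈ proper → (A , oneP) ≢ x
  A1∉ x∈ refl =
    proj₁ (proj₂ (properSquareFree⇒ {A} {A} {oneP} (proj₂ (∈-filterᵇ⁻ (properSquareFree A) (divPairs A) x∈)))) refl
  unique : Unique ((A , oneP) ∷ proper)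
  unique = All.tabulate A1∉ ∷ filterᵇ-Unique (properSquareFree A) (divPairs-Unique A)
  to : ∀ {x} → x ∈ (A , oneP) ∷ proper → x ∈ squareFreeSplittings A
  to (here refl) = ∈-filterᵇ⁺ (squarefreeᵇ ∘ proj₂) (∈-divPairs⁺ A≢[] nA oneP-NF (*P-identityʳ nA)) _
  to {D , Q} (there x∈) with ∈-filterᵇ⁻ (properSquareFree A) (divPairs A) x∈
  ... | DQ∈ , isProper =
    ∈-filterᵇ⁺ (squarefreeᵇ ∘ proj₂) DQ∈ (proj₂ (proj₂ (properSquareFree⇒ {A} {D} {Q} isProper)))
  from : ∀ {x} → x ∈ squareFreeSplittings A → x ∈ (A , oneP) ∷ proper
  from {D , Q} DQ∈ with ∈-filterᵇ⁻ (squarefreeᵇ ∘ proj₂) (divPairs A) DQ∈ | D ≟P A | D ≟P oneP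
  ... | _ | yes refl | _ = here (cong (A ,_) (sym (*P-cancelˡ nA A≢[] oneP-NF (Q-NF s)
                              (trans (*P-identityʳ nA) (sym (product s))))))
    where
    s = ∈-squareFreeSplittings⁻ A≢[] DQ∈
    open SquareFreeSplitting
  ... | _ | no _ | yes refl = ⊥-elim (¬sfA (subst SquareFree Q≡A (squareFree s)))
    where
    s = ∈-squareFreeSplittings⁻ A≢[] DQ∈
    open SquareFreeSplitting
    Q≡A = trans (sym (norm-idem (Q-NF s))) (trans (sym (*P-identityˡ Q)) (product s))
  ... | DQ∈′ , sfQ | no D≢A | no D≢1 =
    there (∈-filterᵇ⁺ (properSquareFree A) DQ∈′ (⇒properSquareFree {A} {D} {Q} D≢1 D≢A sfQ))

corSum-NF : ∀ A → NF (corSum A)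
corSum-NF A = sumP-NF (map (σ ∘ proj₁) (filterᵇ (properSquareFree A) (divPairs A)))

σ+corSum : ∀ {A} → NF A → A ≢ [] → ¬ SquareFree A → σ A +P corSum A ≡ A
σ+corSum {A} nA A≢[] ¬sfA = begin
  σ A +P corSum A                                   ≡⟨ sumP-↭ (↭-map⁺ (σ ∘ proj₁) (squareFreeSplittings-↭ nA A≢[] ¬sfA)) ⟩
  sumP (map (σ ∘ proj₁) (squareFreeSplittings A))   ≡⟨ Fubini.sumσ-squareFreeSplittings A≢[] nA ⟩
  A                                                 ∎
  where open ≡-Reasoning

corollary3p10 : (A : Poly) → Normal A → Odd A → Perfect A → corSum A ≡ zeroP
corollary3p10 A normal odd@(A≢[] , _) perfect with A ≟P oneP
... | yes refl = refl
... | no A≢1 = begin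
  corSum A                   ≡⟨ sym (norm-idem (corSum-NF A)) ⟩
  [] +P corSum A             ≡⟨ cong (_+P corSum A) (sym (+P-self A)) ⟩
  (A +P A) +P corSum A       ≡⟨ +P-assoc A A (corSum A) ⟩
  A +P (A +P corSum A)       ≡⟨ cong (λ B → A +P (B +P corSum A)) (sym perfect) ⟩
  A +P (σ A +P corSum A)     ≡⟨ cong (A +P_) (σ+corSum nA A≢[] (Odd-perfect⇒¬SquareFree nA odd perfect A≢1)) ⟩
  A +P A                     ≡⟨ +P-self A ⟩
  []                         ∎
  where
  open ≡-Reasoning
  nA = Normal⇒NF normal
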